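{- In Normal Infinite Hex, the mirroring strategy $\mu$ is a drawing strategy for the second player (Blue): every play in which Blue follows $\mu$ is not a win for Red.
   Context: Infinite Hex board: cells are pairs $(a,j)$ with $j\in\mathbb{Z}$ and $a\in\mathbb{Z}+j/2$; $(a,j),(a',j')$ adjacent iff ($j=j'$, $|a-a'|=1$) or ($|j-j'|=1$, $|a-a'|=1/2$). A Red (Blue) $\mathbb{Z}$-chain in a configuration is $r:\mathbb{Z}\to$ cells with all $r(n)$ Red (Blue) and $r(n),r(n+1)$ adjacent. A Red chain is winning w.r.t. $h_0=(a_0,j_0)$ if there is $M$ with, for all $m\ge M$, $r(m)=(a,j)$ having $a>a_0,j>j_0$ and $r(-m)=(a,j)$ having $a<a_0,j<j_0$; a Blue chain $b$ is winning w.r.t. $h_0$ if eventually $b(m)$ has $a<a_0,j>j_0$ and $b(-m)$ has $a>a_0,j<j_0$. A chain is winning if winning w.r.t. every cell. Normal Infinite Hex: starting from the empty board, Red (first) and Blue alternately mark an empty cell in their colour, for $\omega$ many turns; Red wins the play if the set of cells marked Red during the play contains a winning Red chain, and Blue wins if the Blue cells contain a winning Blue chain; otherwise it is a draw. Mirroring strategy: let $\theta$ be the involution of the cells given by $\theta(a,j)=(a+\tfrac12,-1-j)$ if $j\le -1$ and $\theta(a,j)=(a-\tfrac12,-1-j)$ if $j\ge 0$ (reflection across the East–West axis between rows $-1$ and $0$ followed by a half-cell shift, each cell of row $-1$ being paired with its North-East neighbour in row $0$). The strategy $\mu$ for Blue: whenever Red marks a cell $h$, Blue marks $\theta(h)$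 on her next move. -}

module Defs where

open import Data.Nat as ℕ using (ℕ)
open import Data.Integer as ℤ using (ℤ; +_; -[1+_]; _+_; _-_; _*_; -_; ∣_∣; _<_; _>_)
open import Data.Product using (Σ; ∃; _×_; _,_; proj₁; proj₂)
open import Data.Sum using (_⊎_)
open import Relation.Binary.PropositionalEquality using (_≡_)
open import Function.Definitions using (Injective)

-- A cell (a , j) with j ∈ ℤ and a ∈ ℤ + j/2 is encoded by the integer pair
-- (x , j) where a = x + j/2 ; this is a bijection between ℤ × ℤ and the cells.
Cell : Set
Cell = ℤ × ℤ

row : Cell → ℤ
row = proj₂

-- twice the (half-integer) coordinate a :  2a = 2x + j
a2 : Cell → ℤ
a2 (x , j) = (+ 2) * x + j

-- adjacency: (j = j' and |a - a'| = 1) or (|j - j'| = 1 and |a - a'| = 1/2),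
-- written with doubled a-coordinates.
Adjacent : Cell → Cell → Set
Adjacent c c' =
  (row c ≡ row c' × ∣ a2 c - a2 c' ∣ ≡ 2)
  ⊎ (∣ row c - row c' ∣ ≡ 1 × ∣ a2 c - a2 c' ∣ ≡ 1)

IsChain : (Cell → Set) → (ℤ → Cell) → Set
IsChain P r = (∀ n → P (r n)) × (∀ n → Adjacent (r n) (r (n + + 1)))

-- Red chain winning w.r.t. h₀ : eventually r(m) is North-East of h₀ and r(-m)
-- is South-West of h₀  (a > a₀ ⇔ 2a > 2a₀)
RedWinningWrt : (ℤ → Cell) → Cell → Set
RedWinningWrt r h₀ = Σ ℕ λ M → ∀ (m : ℕ) → M ℕ.≤ m →
  (a2 (r (+ m)) > a2 h₀ × row (r (+ m)) > row h₀)
  × (a2 (r (- (+ m))) < a2 h₀ × row (r (- (+ m))) < row h₀)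

RedWinning : (ℤ → Cell) → Set
RedWinning r = ∀ h₀ → RedWinningWrt r h₀

-- A play of ω turns: move i is the cell marked at turn i;
-- even turns are Red's (Red moves first), odd turns are Blue's.
Play : Set
Play = ℕ → Cell

-- legality: every move marks an empty cell, i.e. all marked cells are distinct
Legal : Play → Set
Legal p = Injective _≡_ _≡_ p

MarkedRed : Play → Cell → Set
MarkedRed p c = ∃ λ k → p (2 ℕ.* k) ≡ c

RedWins : Play → Set
RedWins p = ∃ λ (r : ℤ → Cell) → IsChain (MarkedRed p) r × RedWinning r

-- the involution θ:  (a , j) ↦ (a + 1/2 , -1 - j) if j ≤ -1,
--                    (a , j) ↦ (a - 1/2 , -1 - j) if j ≥ 0.
-- In (x , j) coordinates (a = x + j/2) this is x' = x + j + 1 resp. x' = x + j.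
θ : Cell → Cell
θ (x , j@(-[1+ _ ])) = (x + j + + 1 , - (+ 1) - j)
θ (x , j@(+ _))      = (x + j , - (+ 1) - j)

FollowsMirror : Play → Set
FollowsMirror p = ∀ k → p (ℕ.suc (2 ℕ.* k)) ≡ θ (p (2 ℕ.* k))

module Submission where

-- Suppose the Red cells contained a winning chain r. Blue's replies contain its mirror image
-- β = θ ∘ r, and β is disjoint from r: θ of a Red move is the Blue move answering it, and no
-- cell is marked twice. θ turns every step of r into a lattice step, except the steps of r
-- across the axis between rows -1 and 0, which become non-lattice "jumps".
--
-- For a cell c of r let N(c) be the signed number of crossings of (a long piece of) β with the
-- ray running east from c between its row and the next one. Moving c one step along r changes
-- N by boundary terms, negligible far out, and by the signed crossings of that step with β.
-- Disjoint lattice steps never cross, so only jumps count, and the r-step n meets the jump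
-- coming from the r-step k exactly when both cross the axis at the same edge; the contribution
-- is -s(n) s(k), s being the direction of the crossing. Summed along r, N changes by
-- -Σ_e (Σ_{n crosses e} s(n))² ≤ 0. Yet β lies beside the ray from the far north-east end of r
-- (N = 0), and crosses the ray from the far south-west end exactly once, downwards (N = -1).

open import Defs
open import Relation.Nullary using (¬_)

open import Algebra.Bundles using (AbelianGroup)
open import Data.Bool using (Bool; true; false; _∧_; _∨_; not; T)
open import Data.Bool.ListAction using (all)
open import Data.Bool.Properties using (T-∧; T-∨)
open import Data.Empty using (⊥; ⊥-elim)
open import Data.Integer as ℤ
  using (ℤ; +_; -[1+_]; _+_; _-_; _*_; -_; ∣_∣; _≤_; _<_; _>_; +≤+; -≤+; -≤-; -<+; +<+)
import Data.Integer.Properties as ℤP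
open import Data.Integer.Tactic.RingSolver using (solve-∀)
open import Data.List using (List; []; _∷_; map)
open import Data.List.Membership.Propositional using (_∈_)
open import Data.List.Membership.Propositional.Properties using (∈-map⁺)
import Data.List.Relation.Unary.All as All
open import Data.List.Relation.Unary.All.Properties using (all⁺)
open import Data.List.Relation.Unary.Any using (here; there)
open import Data.Nat as ℕ using (ℕ; zero; suc; z≤n; s≤s)
import Data.Nat.Properties as ℕP
open import Data.Product using (Σ; _×_; _,_; proj₁; proj₂)
open import Data.Sum using (_⊎_; inj₁; inj₂; [_,_]′)
open import Function using (_∘_; _|>_; Equivalence)
open import Relation.Binary.PropositionalEquality
open import Relation.Nullary using (yes; no; does)
open import Relation.Nullary.Decidable using (dec-false)

open import Algebra.Properties.Group (AbelianGroup.group ℤP.+-0-abelianGroup)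
  using () renaming (∙-cancelʳ to +-cancelʳ)

infix 4 _==_ _<=_ _≐_

_==_ : ℤ → ℤ → Bool
a == b = does (a ℤ.≟ b)

_<=_ : ℤ → ℤ → Bool
a <= b = does (a ℤ.≤? b)

𝟙 : Bool → ℤ
𝟙 true  = + 1
𝟙 false = + 0

==⇒≡ : ∀ a b → T (a == b) → a ≡ b
==⇒≡ a b p with a ℤ.≟ b
... | yes a≡b = a≡b

𝟙-==-⇔ : ∀ {u v u′ v′} → (u ≡ v → u′ ≡ v′) → (u′ ≡ v′ → u ≡ v) → 𝟙 (u == v) ≡ 𝟙 (u′ == v′)
𝟙-==-⇔ {u} {v} {u′} {v′} to from with u ℤ.≟ v | u′ ℤ.≟ v′
... | yes _   | yes _    = refl
... | no _    | no _     = refl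
... | yes u≡v | no u′≢v′ = ⊥-elim (u′≢v′ (to u≡v))
... | no u≢v  | yes u′≡v′ = ⊥-elim (u≢v (from u′≡v′))

𝟙-==-sym : ∀ u v → 𝟙 (u == v) ≡ 𝟙 (v == u)
𝟙-==-sym u v = 𝟙-==-⇔ {u} {v} sym sym

𝟙-==-diff : ∀ u v u′ v′ → u - v ≡ u′ - v′ → 𝟙 (u == v) ≡ 𝟙 (u′ == v′)
𝟙-==-diff u v u′ v′ eq =
  𝟙-==-⇔ (λ u≡v → ℤP.i-j≡0⇒i≡j u′ v′ (trans (sym eq) (ℤP.i≡j⇒i-j≡0 u≡v)))
       (λ u′≡v′ → ℤP.i-j≡0⇒i≡j u v (trans eq (ℤP.i≡j⇒i-j≡0 u′≡v′)))

𝟙-∧ : ∀ x y → 𝟙 (x ∧ y) ≡ 𝟙 x * 𝟙 y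
𝟙-∧ true  true  = refl
𝟙-∧ true  false = refl
𝟙-∧ false true  = refl
𝟙-∧ false false = refl

not-∨⇒ : ∀ {x y} → T (not x ∨ y) → T x → T y
not-∨⇒ {true} p _ = p

all-sound : ∀ {A : Set} (p : A → Bool) xs → T (all p xs) → ∀ {x} → x ∈ xs → T (p x)
all-sound p xs ok = All.lookup (all⁺ p xs ok)

all² : ∀ {A B : Set} → (A → B → Bool) → List A → List B → Bool
all² p xs ys = all (λ x → all (p x) ys) xs

all²-sound : ∀ {A B : Set} (p : A → B → Bool) xs ys → T (all² p xs ys) →
             ∀ {x y} → x ∈ xs → y ∈ ys → T (p x y)
all²-sound p xs ys ok x∈ y∈ = all-sound (p _) ys (all-sound _ xs ok x∈) y∈

-- Integer arithmetic and finite sums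

i<i+1 : ∀ i → i < i + + 1
i<i+1 i = ℤP.≤-<-trans (ℤP.≤-reflexive (sym (ℤP.+-identityʳ i))) (ℤP.+-monoʳ-< i (+<+ (s≤s z≤n)))

≤-from-diff : ∀ a b → + 0 ≤ b - a → a ≤ b
≤-from-diff a b 0≤b-a = subst (_≤ b) (ℤP.+-identityʳ a) (subst (a + + 0 ≤_) (eq a b) (ℤP.+-monoʳ-≤ a 0≤b-a))
  where
  eq : ∀ a b → a + (b - a) ≡ b
  eq = solve-∀

diff-nonneg : ∀ {a b} → a ≤ b → + 0 ≤ b - a
diff-nonneg {a} {b} a≤b = subst (_≤ b - a) (ℤP.+-inverseʳ a) (ℤP.+-monoˡ-≤ (- a) a≤b)

diff-1-nonneg : ∀ {a b} → a < b → + 0 ≤ b - a - + 1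
diff-1-nonneg {a} {b} a<b = subst (+ 0 ≤_) (eq a b) (diff-nonneg (ℤP.i<j⇒suc[i]≤j a<b))
  where
  eq : ∀ a b → b - (+ 1 + a) ≡ b - a - + 1
  eq = solve-∀

≤-neg-form : ∀ z M → z ≤ - + M → Σ ℕ λ n → M ℕ.≤ n × z ≡ - + n
≤-neg-form (+ zero)    zero    _          = 0 , z≤n , refl
≤-neg-form (+ suc n)   zero    (+≤+ ())
≤-neg-form -[1+ n ]    zero    _          = suc n , z≤n , refl
≤-neg-form -[1+ n ]    (suc M) (-≤- M≤n)  = suc n , s≤s M≤n , refl

≥-pos-form : ∀ z M → + M ≤ z → Σ ℕ λ n → M ℕ.≤ n × z ≡ + n
≥-pos-form (+ n) M (+≤+ M≤n) = n , M≤n , refl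

window-index : ∀ M k → - + M ≤ k → k < + M → Σ ℕ λ i → i ℕ.< M ℕ.+ M × - + M + + i ≡ k
window-index M k -M≤k k<M = ∣ k + + M ∣ , i<2M , -M+i≡k
  where
  +i≡k+M : + ∣ k + + M ∣ ≡ k + + M
  +i≡k+M = ℤP.0≤i⇒+∣i∣≡i (subst (_≤ k + + M) (ℤP.+-inverseˡ (+ M)) (ℤP.+-monoˡ-≤ (+ M) -M≤k))
  -M+i≡k : - + M + + ∣ k + + M ∣ ≡ k
  -M+i≡k = trans (cong (_+_ (- + M)) +i≡k+M) (eq (+ M) k)
    where
    eq : ∀ a b → - a + (b + a) ≡ b
    eq = solve-∀
  i<2M : ∣ k + + M ∣ ℕ.< M ℕ.+ M
  i<2M = ℤP.drop‿+<+ (subst₂ _<_ (sym +i≡k+M) (sym (ℤP.pos-+ M M)) (ℤP.+-monoˡ-< (+ M) k<M))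

sumFrom : (ℤ → ℤ) → ℤ → ℕ → ℤ
sumFrom f a zero    = + 0
sumFrom f a (suc n) = f a + sumFrom f (a + + 1) n

+-suc-shift : ∀ a i → a + + 1 + + i ≡ a + + suc i
+-suc-shift a i = ℤP.+-assoc a (+ 1) (+ i)

module _ {P : ℤ → Set} where

  head-in-range : ∀ a {n} → (∀ i → i ℕ.< suc n → P (a + + i)) → P a
  head-in-range a h = subst P (ℤP.+-identityʳ a) (h 0 (s≤s z≤n))

  tail-in-range : ∀ a {n} → (∀ i → i ℕ.< suc n → P (a + + i)) → ∀ i → i ℕ.< n → P (a + + 1 + + i)
  tail-in-range a h i i<n = subst P (sym (+-suc-shift a i)) (h (suc i) (s≤s i<n))

sum-cong : ∀ (f g : ℤ → ℤ) a n → (∀ i → i ℕ.< n → f (a + + i) ≡ g (a + + i)) → sumFrom f a n ≡ sumFrom g a n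
sum-cong f g a zero    h = refl
sum-cong f g a (suc n) h =
  cong₂ _+_ (head-in-range {λ k → f k ≡ g k} a h) (sum-cong f g (a + + 1) n (tail-in-range {λ k → f k ≡ g k} a h))

sum-cong′ : ∀ (f g : ℤ → ℤ) a n → (∀ k → f k ≡ g k) → sumFrom f a n ≡ sumFrom g a n
sum-cong′ f g a n h = sum-cong f g a n (λ i _ → h (a + + i))

sum-zero : ∀ (f : ℤ → ℤ) a n → (∀ i → i ℕ.< n → f (a + + i) ≡ + 0) → sumFrom f a n ≡ + 0
sum-zero f a zero    h = refl
sum-zero f a (suc n) h = cong₂ _+_ (head-in-range {λ k → f k ≡ + 0} a h)
                                   (sum-zero f (a + + 1) n (tail-in-range {λ k → f k ≡ + 0} a h))

sum-distrib-+ : ∀ (f g : ℤ → ℤ) a n → sumFrom (λ k → f k + g k) a n ≡ sumFrom f a n + sumFrom g a n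
sum-distrib-+ f g a zero    = refl
sum-distrib-+ f g a (suc n) =
  trans (cong (_+_ (f a + g a)) (sum-distrib-+ f g (a + + 1) n))
        (interchange (f a) (g a) (sumFrom f (a + + 1) n) (sumFrom g (a + + 1) n))
  where
  interchange : ∀ a b c d → (a + b) + (c + d) ≡ (a + c) + (b + d)
  interchange = solve-∀

sum-neg : ∀ (f : ℤ → ℤ) a n → sumFrom (λ k → - f k) a n ≡ - sumFrom f a n
sum-neg f a zero    = refl
sum-neg f a (suc n) = trans (cong (_+_ (- f a)) (sum-neg f (a + + 1) n)) (sym (ℤP.neg-distrib-+ (f a) _))

sum-*ˡ : ∀ c (f : ℤ → ℤ) a n → sumFrom (λ k → c * f k) a n ≡ c * sumFrom f a n
sum-*ˡ c f a zero    = sym (ℤP.*-zeroʳ c)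
sum-*ˡ c f a (suc n) = trans (cong (_+_ (c * f a)) (sum-*ˡ c f (a + + 1) n)) (sym (ℤP.*-distribˡ-+ c (f a) _))

sum-telescope : ∀ (g : ℤ → ℤ) a n → sumFrom (λ k → g (k + + 1) - g k) a n ≡ g (a + + n) - g a
sum-telescope g a zero    = sym (trans (cong (λ k → g k - g a) (ℤP.+-identityʳ a)) (ℤP.+-inverseʳ (g a)))
sum-telescope g a (suc n) rewrite sum-telescope g (a + + 1) n | +-suc-shift a n =
  chain (g a) (g (a + + 1)) (g (a + + suc n))
  where
  chain : ∀ g₀ g₁ gₙ → (g₁ - g₀) + (gₙ - g₁) ≡ gₙ - g₀
  chain = solve-∀

sum-split : ∀ (f : ℤ → ℤ) a p q → sumFrom f a (p ℕ.+ q) ≡ sumFrom f a p + sumFrom f (a + + p) q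
sum-split f a zero    q rewrite ℤP.+-identityʳ a = sym (ℤP.+-identityˡ _)
sum-split f a (suc p) q rewrite sum-split f (a + + 1) p q | +-suc-shift a p = sym (ℤP.+-assoc (f a) _ _)

sum-swap : ∀ (F : ℤ → ℤ → ℤ) a n b m →
  sumFrom (λ i → sumFrom (F i) b m) a n ≡ sumFrom (λ j → sumFrom (λ i → F i j) a n) b m
sum-swap F a zero    b m = sym (sum-zero _ b m (λ _ _ → refl))
sum-swap F a (suc n) b m =
  trans (cong (_+_ (sumFrom (F a) b m)) (sum-swap F (a + + 1) n b m))
        (sym (sum-distrib-+ (F a) (λ j → sumFrom (λ i → F i j) (a + + 1) n) b m))

sum-nonneg : ∀ (f : ℤ → ℤ) a n → (∀ i → i ℕ.< n → + 0 ≤ f (a + + i)) → + 0 ≤ sumFrom f a n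
sum-nonneg f a zero    h = +≤+ z≤n
sum-nonneg f a (suc n) h =
  ℤP.+-mono-≤ (head-in-range {λ k → + 0 ≤ f k} a h) (sum-nonneg f (a + + 1) n (tail-in-range {λ k → + 0 ≤ f k} a h))

term≤sum : ∀ (f : ℤ → ℤ) a n → (∀ i → i ℕ.< n → + 0 ≤ f (a + + i)) → ∀ i → i ℕ.< n → f (a + + i) ≤ sumFrom f a n
term≤sum f a (suc n) h zero _ rewrite ℤP.+-identityʳ a =
  ℤP.≤-trans (ℤP.≤-reflexive (sym (ℤP.+-identityʳ (f a))))
             (ℤP.+-monoʳ-≤ (f a) (sum-nonneg f (a + + 1) n (tail-in-range {λ k → + 0 ≤ f k} a h)))
term≤sum f a (suc n) h (suc i) (s≤s i<n) =
  ℤP.≤-trans (ℤP.≤-reflexive (cong f (sym (+-suc-shift a i))))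
  (ℤP.≤-trans (term≤sum f (a + + 1) n (tail-in-range {λ k → + 0 ≤ f k} a h) i i<n)
  (ℤP.≤-trans (ℤP.≤-reflexive (sym (ℤP.+-identityˡ _)))
              (ℤP.+-monoˡ-≤ _ (head-in-range {λ k → + 0 ≤ f k} a h))))

sumAbs : (ℤ → ℤ) → ℤ → ℕ → ℤ
sumAbs f = sumFrom (λ k → + ∣ f k ∣)

sumAbs-nonneg : ∀ f a n → + 0 ≤ sumAbs f a n
sumAbs-nonneg f a n = sum-nonneg _ a n (λ _ _ → +≤+ z≤n)

term-within-sumAbs : ∀ (f : ℤ → ℤ) a n i → i ℕ.< n →
  - sumAbs f a n ≤ f (a + + i) × f (a + + i) ≤ sumAbs f a n
term-within-sumAbs f a n i i<n =
  ℤP.≤-trans (ℤP.neg-mono-≤ ∣f∣≤S) (-∣i∣≤i (f (a + + i))) , ℤP.≤-trans (i≤∣i∣ (f (a + + i))) ∣f∣≤S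
  where
  ∣f∣≤S : + ∣ f (a + + i) ∣ ≤ sumAbs f a n
  ∣f∣≤S = term≤sum _ a n (λ _ _ → +≤+ z≤n) i i<n
  i≤∣i∣ : ∀ i → i ≤ + ∣ i ∣
  i≤∣i∣ (+ n)    = ℤP.≤-refl
  i≤∣i∣ -[1+ n ] = -≤+
  -∣i∣≤i : ∀ i → - + ∣ i ∣ ≤ i
  -∣i∣≤i (+ zero)  = ℤP.≤-refl
  -∣i∣≤i (+ suc n) = -≤+
  -∣i∣≤i -[1+ n ]  = ℤP.≤-refl

sumCentred : (ℤ → ℤ) → ℕ → ℤ
sumCentred F m = sumFrom F (- + m) (m ℕ.+ m)

sumCentred-telescope : ∀ (g : ℤ → ℤ) m → sumCentred (λ k → g (k + + 1) - g k) m ≡ g (+ m) - g (- + m)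
sumCentred-telescope g m = trans (sum-telescope g (- + m) (m ℕ.+ m)) (cong (λ k → g k - g (- + m)) (-m+2m≡m m))
  where
  -m+2m≡m : ∀ m → - + m + + (m ℕ.+ m) ≡ + m
  -m+2m≡m m rewrite ℤP.pos-+ m m = eq (+ m)
    where
    eq : ∀ z → - z + (z + z) ≡ z
    eq = solve-∀

private
  -[m+d]+d≡-m : ∀ m d → - + (m ℕ.+ d) + + d ≡ - + m
  -[m+d]+d≡-m m d rewrite ℤP.pos-+ m d = eq (+ m) (+ d)
    where
    eq : ∀ a b → - (a + b) + b ≡ - a
    eq = solve-∀

  -[m+d]+i<-m : ∀ m d i → i ℕ.< d → - + (m ℕ.+ d) + + i < - + m
  -[m+d]+i<-m m d i i<d with ℕP.m≤n⇒∃[o]m+o≡n i<d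
  ... | j , refl rewrite ℤP.pos-+ m (suc (i ℕ.+ j)) | ℤP.pos-+ (suc i) j =
    subst (_< - + m) (sym (eq (+ m) (+ i) (+ j)))
          (ℤP.<-≤-trans (ℤP.+-monoʳ-< (- + m) (-<+ {j} {0})) (ℤP.≤-reflexive (ℤP.+-identityʳ (- + m))))
    where
    eq : ∀ a b c → - (a + (+ 1 + b + c)) + b ≡ - a + - (+ 1 + c)
    eq = solve-∀

  m≤-m+2m+i : ∀ m i → + m ≤ - + m + + (m ℕ.+ m) + + i
  m≤-m+2m+i m i rewrite ℤP.pos-+ m m =
    subst (+ m ≤_) (sym (eq (+ m) (+ i))) (ℤP.≤-trans (ℤP.≤-reflexive (sym (ℤP.+-identityʳ (+ m)))) (ℤP.+-monoʳ-≤ (+ m) (+≤+ z≤n)))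
    where
    eq : ∀ a b → - a + (a + a) + b ≡ a + b
    eq = solve-∀

  [m+d]+[m+d]≡d+[[m+m]+d] : ∀ m d → (m ℕ.+ d) ℕ.+ (m ℕ.+ d) ≡ d ℕ.+ ((m ℕ.+ m) ℕ.+ d)
  [m+d]+[m+d]≡d+[[m+m]+d] = solve-ℕ
    where
    open import Data.Nat.Tactic.RingSolver using () renaming (solve-∀ to solve-ℕ)

sumCentred-extend : ∀ (F : ℤ → ℤ) m d → (∀ k → k < - + m ⊎ + m ≤ k → F k ≡ + 0) →
  sumCentred F (m ℕ.+ d) ≡ sumCentred F m
sumCentred-extend F m d outside≡0
  rewrite [m+d]+[m+d]≡d+[[m+m]+d] m d
        | sum-split F (- + (m ℕ.+ d)) d ((m ℕ.+ m) ℕ.+ d)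
        | sum-split F (- + (m ℕ.+ d) + + d) (m ℕ.+ m) d
        | -[m+d]+d≡-m m d
        | sum-zero F (- + (m ℕ.+ d)) d (λ i i<d → outside≡0 _ (inj₁ (-[m+d]+i<-m m d i i<d)))
        | sum-zero F (- + m + + (m ℕ.+ m)) d (λ i _ → outside≡0 _ (inj₂ (m≤-m+2m+i m i)))
  = trans (ℤP.+-identityˡ _) (ℤP.+-identityʳ _)

sum-𝟙-pick : ∀ (h : ℤ → ℤ) y a n → a ≤ y → y < a + + n → sumFrom (λ x → 𝟙 (y == x) * h x) a n ≡ h y
sum-𝟙-pick h y a zero a≤y y<a =
  ⊥-elim (ℤP.<-irrefl refl (ℤP.≤-<-trans a≤y (subst (y <_) (ℤP.+-identityʳ a) y<a)))
sum-𝟙-pick h y a (suc n) a≤y y<a+n with y ℤ.≟ a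
... | yes refl = trans (cong₂ _+_ (ℤP.*-identityˡ (h y)) later) (ℤP.+-identityʳ (h y))
  where
  y<later : ∀ i → y < y + + 1 + + i
  y<later i = ℤP.<-≤-trans (i<i+1 y) (ℤP.i≤i+j (y + + 1) (+ i))
  later : sumFrom (λ x → 𝟙 (y == x) * h x) (y + + 1) n ≡ + 0
  later = sum-zero _ (y + + 1) n λ i _ →
    trans (cong (λ b → 𝟙 b * h (y + + 1 + + i)) (dec-false (y ℤ.≟ _) (ℤP.<⇒≢ (y<later i))))
          (ℤP.*-zeroˡ (h (y + + 1 + + i)))
... | no y≢a = trans (cong₂ _+_ (ℤP.*-zeroˡ (h a)) (sum-𝟙-pick h y (a + + 1) n a+1≤y y<a+1+n)) (ℤP.+-identityˡ (h y))
  where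
  a+1≤y : a + + 1 ≤ y
  a+1≤y = ℤP.≤-trans (ℤP.≤-reflexive (ℤP.+-comm a (+ 1))) (ℤP.i<j⇒suc[i]≤j (ℤP.≤∧≢⇒< a≤y (y≢a ∘ sym)))
  y<a+1+n : y < a + + 1 + + n
  y<a+1+n = subst (y <_) (sym (+-suc-shift a n)) y<a+n

coincidences : (f g : ℤ → ℤ) → ℤ → ℕ → ℤ
coincidences f g a n = sumFrom (λ i → sumFrom (λ k → f i * f k * 𝟙 (g i == g k)) a n) a n

square-nonneg : ∀ z → + 0 ≤ z * z
square-nonneg (+ zero)  = +≤+ z≤n
square-nonneg (+ suc n) = +≤+ z≤n
square-nonneg -[1+ n ]  = +≤+ z≤n

fibreSum : (f g : ℤ → ℤ) → ℤ → ℕ → ℤ → ℤ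
fibreSum f g a n x = sumFrom (λ i → f i * 𝟙 (g i == x)) a n

coincidences-as-squares : ∀ f g a n lo size → (∀ k → k ℕ.< n → lo ≤ g (a + + k) × g (a + + k) < lo + + size) →
  coincidences f g a n ≡ sumFrom (λ x → fibreSum f g a n x * fibreSum f g a n x) lo size
coincidences-as-squares f g a n lo size in-window = begin
  coincidences f g a n
    ≡⟨ sum-cong _ _ a n (λ i _ → trans (sum-cong _ _ a n (λ k k<n → pair-as-sum i k k<n))
                                       (sum-swap (λ k x → column x (a + + i) * column x k) a n lo size)) ⟩
  sumFrom (λ i → sumFrom (λ x → sumFrom (λ k → column x i * column x k) a n) lo size) a n
    ≡⟨ sum-swap (λ i x → sumFrom (λ k → column x i * column x k) a n) a n lo size ⟩
  sumFrom (λ x → sumFrom (λ i → sumFrom (λ k → column x i * column x k) a n) a n) lo size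
    ≡⟨ sum-cong′ _ _ lo size square ⟩
  sumFrom (λ x → S x * S x) lo size ∎
  where
  open ≡-Reasoning
  column : ℤ → ℤ → ℤ
  column x i = f i * 𝟙 (g i == x)
  S : ℤ → ℤ
  S = fibreSum f g a n

  pair-as-sum : ∀ i k → k ℕ.< n →
    f (a + + i) * f (a + + k) * 𝟙 (g (a + + i) == g (a + + k))
      ≡ sumFrom (λ x → column x (a + + i) * column x (a + + k)) lo size
  pair-as-sum i k k<n = begin
    f I * f K * 𝟙 (g I == g K)
      ≡⟨ cong (_*_ (f I * f K)) (sym (sum-𝟙-pick (λ x → 𝟙 (g I == x)) (g K) lo size
                                    (proj₁ (in-window k k<n)) (proj₂ (in-window k k<n)))) ⟩
    f I * f K * sumFrom (λ x → 𝟙 (g K == x) * 𝟙 (g I == x)) lo size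
      ≡⟨ sym (sum-*ˡ (f I * f K) _ lo size) ⟩
    sumFrom (λ x → f I * f K * (𝟙 (g K == x) * 𝟙 (g I == x))) lo size
      ≡⟨ sum-cong′ _ _ lo size (λ x → rearrange (f I) (f K) (𝟙 (g K == x)) (𝟙 (g I == x))) ⟩
    sumFrom (λ x → column x I * column x K) lo size ∎
    where
    I K : ℤ
    I = a + + i
    K = a + + k
    rearrange : ∀ a b c d → a * b * (c * d) ≡ (a * d) * (b * c)
    rearrange = solve-∀

  square : ∀ x → sumFrom (λ i → sumFrom (λ k → column x i * column x k) a n) a n ≡ S x * S x
  square x = begin
    sumFrom (λ i → sumFrom (λ k → column x i * column x k) a n) a n
      ≡⟨ sum-cong′ _ _ a n (λ i → trans (sum-*ˡ (column x i) (column x) a n) (ℤP.*-comm (column x i) (S x))) ⟩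
    sumFrom (λ i → S x * column x i) a n
      ≡⟨ sum-*ˡ (S x) (column x) a n ⟩
    S x * S x ∎

coincidences-nonneg : ∀ f g a n → + 0 ≤ coincidences f g a n
coincidences-nonneg f g a n =
  subst (+ 0 ≤_) (sym (coincidences-as-squares f g a n (- B) size in-window))
        (sum-nonneg _ (- B) size (λ x _ → square-nonneg (fibreSum f g a n (- B + + x))))
  where
  B : ℤ
  B = sumAbs g a n
  size : ℕ
  size = ∣ B + B + + 1 ∣
  -B+size≡B+1 : - B + + size ≡ B + + 1
  -B+size≡B+1 =
    trans (cong (_+_ (- B)) (ℤP.0≤i⇒+∣i∣≡i (ℤP.+-mono-≤ (ℤP.+-mono-≤ 0≤B 0≤B) (+≤+ z≤n)))) (eq B)
    where
    0≤B : + 0 ≤ B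
    0≤B = sumAbs-nonneg g a n
    eq : ∀ B → - B + (B + B + + 1) ≡ B + + 1
    eq = solve-∀
  in-window : ∀ k → k ℕ.< n → - B ≤ g (a + + k) × g (a + + k) < - B + + size
  in-window k k<n with term-within-sumAbs g a n k k<n
  ... | -B≤g , g≤B = -B≤g , subst (g (a + + k) <_) (sym -B+size≡B+1) (ℤP.≤-<-trans g≤B (i<i+1 B))

-- Offsets, directions and steps

Offset : Set
Offset = ℤ × ℤ

infixl 6 _⊕_
infix 8 ⊝_

_⊕_ : Offset → Offset → Offset
(a , b) ⊕ (c , d) = (a + c , b + d)

⊝_ : Offset → Offset
⊝ (a , b) = (- a , - b)

_⊖_ : Cell → Cell → Offset
(x , j) ⊖ (y , i) = (x - y , j - i)

_≐_ : Offset → Offset → Bool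
(a , b) ≐ (c , d) = (a == c) ∧ (b == d)

≐⇒≡ : ∀ u v → T (u ≐ v) → u ≡ v
≐⇒≡ (a , b) (c , d) p with Equivalence.to (T-∧ {a == c}) p
... | pa , pb = cong₂ _,_ (==⇒≡ a c pa) (==⇒≡ b d pb)

⊕-⊖-cancel : ∀ c d → d ≡ c ⊕ (d ⊖ c)
⊕-⊖-cancel (x , j) (y , i) = cong₂ _,_ (eq x y) (eq j i)
  where
  eq : ∀ a b → b ≡ a + (b - a)
  eq = solve-∀

⊖-⊕ˡ : ∀ d c v → d ⊖ (c ⊕ v) ≡ (d ⊖ c) ⊕ ⊝ v
⊖-⊕ˡ (y , i) (x , j) (a , b) = cong₂ _,_ (eq y x a) (eq i j b)
  where
  eq : ∀ y x a → y - (x + a) ≡ y - x + - a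
  eq = solve-∀

⊖-⊕ʳ : ∀ d v c → (d ⊕ v) ⊖ c ≡ (d ⊖ c) ⊕ v
⊖-⊕ʳ (y , i) (a , b) (x , j) = cong₂ _,_ (eq y a x) (eq i b j)
  where
  eq : ∀ y a x → y + a - x ≡ y - x + a
  eq = solve-∀

⊖≡⇒≡⊕ : ∀ d c v → d ⊖ c ≡ v → d ≡ c ⊕ v
⊖≡⇒≡⊕ d c v d⊖c≡v = trans (⊕-⊖-cancel c d) (cong (c ⊕_) d⊖c≡v)

⊖≡0⇒≡ : ∀ d c → d ⊖ c ≡ (+ 0 , + 0) → d ≡ c
⊖≡0⇒≡ d c@(x , j) d⊖c≡0 = trans (⊖≡⇒≡⊕ d c _ d⊖c≡0) (cong₂ _,_ (ℤP.+-identityʳ x) (ℤP.+-identityʳ j))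

row-⊖ : ∀ d c → row (d ⊖ c) ≡ row d - row c
row-⊖ (y , i) (x , j) = refl

a2-⊖ : ∀ d c → a2 (d ⊖ c) ≡ a2 d - a2 c
a2-⊖ (y , i) (x , j) = eq x j y i
  where
  eq : ∀ x j y i → + 2 * (y - x) + (i - j) ≡ + 2 * y + i - (+ 2 * x + j)
  eq = solve-∀

data Dir : Set where
  E NE NW W SW SE : Dir

dirOffset : Dir → Offset
dirOffset E  = (+ 1 , + 0)
dirOffset NE = (+ 0 , + 1)
dirOffset NW = (-[1+ 0 ] , + 1)
dirOffset W  = (-[1+ 0 ] , + 0)
dirOffset SW = (+ 0 , -[1+ 0 ])
dirOffset SE = (+ 1 , -[1+ 0 ])

data Step : Set where
  move : Dir → Step
  jump₋ jump₊ : Step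

stepOffset : Step → Offset
stepOffset (move δ) = dirOffset δ
stepOffset jump₋    = (-[1+ 0 ] , -[1+ 0 ])
stepOffset jump₊    = (+ 1 , + 1)

dirs : List Dir
dirs = E ∷ NE ∷ NW ∷ W ∷ SW ∷ SE ∷ []

steps : List Step
steps = jump₋ ∷ jump₊ ∷ map move dirs

∈-dirs : ∀ δ → δ ∈ dirs
∈-dirs E  = here refl
∈-dirs NE = there (here refl)
∈-dirs NW = there (there (here refl))
∈-dirs W  = there (there (there (here refl)))
∈-dirs SW = there (there (there (there (here refl))))
∈-dirs SE = there (there (there (there (there (here refl)))))

∈-steps : ∀ t → t ∈ steps
∈-steps jump₋    = here refl
∈-steps jump₊    = there (here refl)
∈-steps (move δ) = there (there (∈-map⁺ move (∈-dirs δ)))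

∣i∣≡1 : ∀ z → ∣ z ∣ ≡ 1 → z ≡ + 1 ⊎ z ≡ -[1+ 0 ]
∣i∣≡1 (+ 1) _ = inj₁ refl
∣i∣≡1 -[1+ 0 ] _ = inj₂ refl
∣i∣≡1 (+ 0) ()
∣i∣≡1 (+ suc (suc n)) ()
∣i∣≡1 -[1+ suc n ] ()

unitStep-dir : ∀ dx dj →
  (dj ≡ + 0 × ∣ + 2 * dx + dj ∣ ≡ 2) ⊎ (∣ dj ∣ ≡ 1 × ∣ + 2 * dx + dj ∣ ≡ 1) →
  Σ Dir λ δ → (dx , dj) ≡ dirOffset δ
unitStep-dir dx dj (inj₁ (refl , ∣2dx∣≡2)) with ∣i∣≡1 dx (ℕP.*-cancelˡ-≡ ∣ dx ∣ 1 2 ∣2dx∣≡2′)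
  where
  ∣2dx∣≡2′ : 2 ℕ.* ∣ dx ∣ ≡ 2 ℕ.* 1
  ∣2dx∣≡2′ = trans (sym (ℤP.abs-* (+ 2) dx)) (trans (cong ∣_∣ (sym (ℤP.+-identityʳ (+ 2 * dx)))) ∣2dx∣≡2)
... | inj₁ refl = E , refl
... | inj₂ refl = W , refl
unitStep-dir dx dj (inj₂ (∣dj∣≡1 , ∣a∣≡1)) with ∣i∣≡1 dj ∣dj∣≡1 | ∣i∣≡1 (+ 2 * dx + dj) ∣a∣≡1
... | inj₁ refl | inj₁ a≡1  rewrite ℤP.*-cancelˡ-≡ (+ 2) dx (+ 0)      (+-cancelʳ _ _ _ a≡1) = NE , refl
... | inj₁ refl | inj₂ a≡-1 rewrite ℤP.*-cancelˡ-≡ (+ 2) dx -[1+ 0 ] (+-cancelʳ _ _ _ a≡-1) = NW , refl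
... | inj₂ refl | inj₁ a≡1  rewrite ℤP.*-cancelˡ-≡ (+ 2) dx (+ 1)      (+-cancelʳ _ _ _ a≡1) = SE , refl
... | inj₂ refl | inj₂ a≡-1 rewrite ℤP.*-cancelˡ-≡ (+ 2) dx (+ 0)      (+-cancelʳ _ _ _ a≡-1) = SW , refl

adjacent-dir : ∀ c d → Adjacent c d → Σ Dir λ δ → d ≡ c ⊕ dirOffset δ
adjacent-dir c@(x , j) d@(y , i) adj with unitStep-dir (y - x) (i - j) (unitStep adj)
  where
  ∣a2-diff∣ : ∣ a2 c - a2 d ∣ ≡ ∣ + 2 * (y - x) + (i - j) ∣
  ∣a2-diff∣ = trans (ℤP.∣i-j∣≡∣j-i∣ (a2 c) (a2 d)) (cong ∣_∣ (eq x j y i))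
    where
    eq : ∀ x j y i → + 2 * y + i - (+ 2 * x + j) ≡ + 2 * (y - x) + (i - j)
    eq = solve-∀
  unitStep : Adjacent c d →
    (i - j ≡ + 0 × ∣ + 2 * (y - x) + (i - j) ∣ ≡ 2) ⊎ (∣ i - j ∣ ≡ 1 × ∣ + 2 * (y - x) + (i - j) ∣ ≡ 1)
  unitStep (inj₁ (j≡i , ∣a∣≡2)) = inj₁ (ℤP.i≡j⇒i-j≡0 (sym j≡i) , trans (sym ∣a2-diff∣) ∣a∣≡2)
  unitStep (inj₂ (∣j-i∣≡1 , ∣a∣≡1)) =
    inj₂ (trans (ℤP.∣i-j∣≡∣j-i∣ i j) ∣j-i∣≡1 , trans (sym ∣a2-diff∣) ∣a∣≡1)
... | δ , d⊖c≡δ = δ , trans (⊕-⊖-cancel c d) (cong (c ⊕_) d⊖c≡δ)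

-- Clamping

clamp₃ : ℤ → ℤ
clamp₃ (+ 0) = + 0
clamp₃ (+ 1) = + 1
clamp₃ (+ 2) = + 2
clamp₃ (+ suc (suc (suc n))) = + 3
clamp₃ -[1+ 0 ] = -[1+ 0 ]
clamp₃ -[1+ 1 ] = -[1+ 1 ]
clamp₃ -[1+ suc (suc n) ] = -[1+ 2 ]

clamp₄ : ℤ → ℤ
clamp₄ (+ 0) = + 0
clamp₄ (+ 1) = + 1
clamp₄ (+ 2) = + 2
clamp₄ (+ 3) = + 3
clamp₄ (+ suc (suc (suc (suc n)))) = + 4
clamp₄ -[1+ 0 ] = -[1+ 0 ]
clamp₄ -[1+ 1 ] = -[1+ 1 ]
clamp₄ -[1+ 2 ] = -[1+ 2 ]
clamp₄ -[1+ suc (suc (suc n)) ] = -[1+ 3 ]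

data Small : ℤ → Set where
  small₀ : Small (+ 0)
  small₊ : Small (+ 1)
  small₋ : Small -[1+ 0 ]

-- The local counts below read offsets only through clamp, i.e. with entries clamped to [-3,3].
-- Since clamp₃ (z + k) depends only on clamp₄ z for |k| ≤ 1, identities between them need
-- only be checked on the window [-4,4]².
clamp₃-+-small : ∀ z {k} → Small k → clamp₃ (z + k) ≡ clamp₃ (clamp₄ z + k)
clamp₃-+-small (+ 0) _ = refl
clamp₃-+-small (+ 1) _ = refl
clamp₃-+-small (+ 2) _ = refl
clamp₃-+-small (+ 3) _ = refl
clamp₃-+-small -[1+ 0 ] _ = refl
clamp₃-+-small -[1+ 1 ] _ = refl
clamp₃-+-small -[1+ 2 ] _ = refl
clamp₃-+-small (+ suc (suc (suc (suc n)))) small₀ = refl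
clamp₃-+-small (+ suc (suc (suc (suc n)))) small₊ = refl
clamp₃-+-small (+ suc (suc (suc (suc n)))) small₋ = refl
clamp₃-+-small -[1+ suc (suc (suc n)) ] small₀ = refl
clamp₃-+-small -[1+ suc (suc (suc n)) ] small₊ = refl
clamp₃-+-small -[1+ suc (suc (suc n)) ] small₋ = refl

clamp₃-small : ∀ {p} → Small p → clamp₃ p ≡ p
clamp₃-small small₀ = refl
clamp₃-small small₊ = refl
clamp₃-small small₋ = refl

clamp₃-small-injective : ∀ z {k} → Small k → clamp₃ z ≡ k → z ≡ k
clamp₃-small-injective (+ 0) small₀ _ = refl
clamp₃-small-injective (+ 1) small₊ _ = refl
clamp₃-small-injective -[1+ 0 ] small₋ _ = refl
clamp₃-small-injective (+ 0) small₊ ()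
clamp₃-small-injective (+ 0) small₋ ()
clamp₃-small-injective (+ 1) small₀ ()
clamp₃-small-injective (+ 1) small₋ ()
clamp₃-small-injective (+ 2) small₀ ()
clamp₃-small-injective (+ 2) small₊ ()
clamp₃-small-injective (+ 2) small₋ ()
clamp₃-small-injective (+ suc (suc (suc n))) small₀ ()
clamp₃-small-injective (+ suc (suc (suc n))) small₊ ()
clamp₃-small-injective (+ suc (suc (suc n))) small₋ ()
clamp₃-small-injective -[1+ 0 ] small₀ ()
clamp₃-small-injective -[1+ 0 ] small₊ ()
clamp₃-small-injective -[1+ 1 ] small₀ ()
clamp₃-small-injective -[1+ 1 ] small₊ ()
clamp₃-small-injective -[1+ 1 ] small₋ ()
clamp₃-small-injective -[1+ suc (suc n) ] small₀ ()
clamp₃-small-injective -[1+ suc (suc n) ] small₊ ()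
clamp₃-small-injective -[1+ suc (suc n) ] small₋ ()

clamp₃-below : ∀ z → z ≤ -[1+ 2 ] → clamp₃ z ≡ -[1+ 2 ]
clamp₃-below -[1+ suc (suc n) ] _ = refl
clamp₃-below -[1+ 0 ] (-≤- ())
clamp₃-below -[1+ 1 ] (-≤- (s≤s ()))

clamp₃-above : ∀ z → + 3 ≤ z → clamp₃ z ≡ + 3
clamp₃-above (+ suc (suc (suc n))) _ = refl
clamp₃-above (+ 0) (+≤+ ())
clamp₃-above (+ 1) (+≤+ (s≤s ()))
clamp₃-above (+ 2) (+≤+ (s≤s (s≤s ())))

window : List ℤ
window = -[1+ 3 ] ∷ -[1+ 2 ] ∷ -[1+ 1 ] ∷ -[1+ 0 ] ∷ + 0 ∷ + 1 ∷ + 2 ∷ + 3 ∷ + 4 ∷ []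

clamp₄-∈-window : ∀ z → clamp₄ z ∈ window
clamp₄-∈-window -[1+ suc (suc (suc n)) ] = here refl
clamp₄-∈-window -[1+ 2 ] = there (here refl)
clamp₄-∈-window -[1+ 1 ] = there (there (here refl))
clamp₄-∈-window -[1+ 0 ] = there (there (there (here refl)))
clamp₄-∈-window (+ 0) = there (there (there (there (here refl))))
clamp₄-∈-window (+ 1) = there (there (there (there (there (here refl)))))
clamp₄-∈-window (+ 2) = there (there (there (there (there (there (here refl))))))
clamp₄-∈-window (+ 3) = there (there (there (there (there (there (there (here refl)))))))
clamp₄-∈-window (+ suc (suc (suc (suc n)))) = there (there (there (there (there (there (there (there (here refl))))))))

clamp : Offset → Offset
clamp (a , b) = (clamp₃ a , clamp₃ b)

clampWindow : Offset → Offset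
clampWindow (a , b) = (clamp₄ a , clamp₄ b)

SmallOffset : Offset → Set
SmallOffset (a , b) = Small a × Small b

clamp-⊕-small : ∀ e {v} → SmallOffset v → clamp (e ⊕ v) ≡ clamp (clampWindow e ⊕ v)
clamp-⊕-small (a , b) (sa , sb) = cong₂ _,_ (clamp₃-+-small a sa) (clamp₃-+-small b sb)

clamp-clampWindow : ∀ e → clamp e ≡ clamp (clampWindow e)
clamp-clampWindow (a , b) = begin
  clamp (a , b)                         ≡⟨ cong clamp (sym (⊕-identityʳ (a , b))) ⟩
  clamp ((a , b) ⊕ (+ 0 , + 0))         ≡⟨ clamp-⊕-small (a , b) (small₀ , small₀) ⟩
  clamp (clampWindow (a , b) ⊕ (+ 0 , + 0)) ≡⟨ cong clamp (⊕-identityʳ (clampWindow (a , b))) ⟩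
  clamp (clampWindow (a , b))               ∎
  where
  open ≡-Reasoning
  ⊕-identityʳ : ∀ e → e ⊕ (+ 0 , + 0) ≡ e
  ⊕-identityʳ (a , b) = cong₂ _,_ (ℤP.+-identityʳ a) (ℤP.+-identityʳ b)

dirOffset-small : ∀ δ → SmallOffset (dirOffset δ)
dirOffset-small E  = small₊ , small₀
dirOffset-small NE = small₀ , small₊
dirOffset-small NW = small₋ , small₊
dirOffset-small W  = small₋ , small₀
dirOffset-small SW = small₀ , small₋
dirOffset-small SE = small₊ , small₋

⊝dirOffset-small : ∀ δ → SmallOffset (⊝ dirOffset δ)
⊝dirOffset-small E  = small₋ , small₀
⊝dirOffset-small NE = small₀ , small₋
⊝dirOffset-small NW = small₊ , small₋
⊝dirOffset-small W  = small₊ , small₀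
⊝dirOffset-small SW = small₀ , small₊
⊝dirOffset-small SE = small₋ , small₊

stepOffset-small : ∀ t → SmallOffset (stepOffset t)
stepOffset-small (move δ) = dirOffset-small δ
stepOffset-small jump₋    = small₋ , small₋
stepOffset-small jump₊    = small₊ , small₊

clamp-≐-small : ∀ e v → SmallOffset v → T (clamp e ≐ v) → e ≡ v
clamp-≐-small (a , b) (c , d) (sc , sd) p with ≐⇒≡ (clamp (a , b)) (c , d) p
... | q = cong₂ _,_ (clamp₃-small-injective a sc (cong proj₁ q)) (clamp₃-small-injective b sd (cong proj₂ q))

𝟙-clamp-≐ : ∀ a b {p q} → Small p → Small q → 𝟙 (clamp (a , b) ≐ (p , q)) ≡ 𝟙 (a == p) * 𝟙 (b == q)
𝟙-clamp-≐ a b {p} {q} sp sq =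
  trans (𝟙-∧ (clamp₃ a == p) (clamp₃ b == q)) (cong₂ _*_ (𝟙-clamp₃ a sp) (𝟙-clamp₃ b sq))
  where
  𝟙-clamp₃ : ∀ z {k} → Small k → 𝟙 (clamp₃ z == k) ≡ 𝟙 (z == k)
  𝟙-clamp₃ z s = 𝟙-==-⇔ (clamp₃-small-injective z s) (λ z≡k → trans (cong clamp₃ z≡k) (clamp₃-small s))

everywhere : (Offset → Bool) → Bool
everywhere P = all² (λ a b → P (a , b)) window window

everywhere-sound : ∀ P → (∀ e → P e ≡ P (clampWindow e)) → T (everywhere P) → ∀ e → T (P e)
everywhere-sound P invariant checked (a , b) =
  subst T (sym (invariant (a , b)))
    (all²-sound (λ a b → P (a , b)) window window checked (clamp₄-∈-window a) (clamp₄-∈-window b))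

-- Local crossing counts

-- The signed crossing (+1 upwards) of the segment from e to e ⊕ t with the ray that starts at
-- the corner shared by the origin cell and its E and NE neighbours and runs east between rows
-- 0 and 1.
crossing : Offset → Step → ℤ
crossing (x , j) t =
  𝟙 ((j == + 0) ∧ ((dj == + 1) ∧ (+ 1 <= x + x + dx)))
  - 𝟙 ((j == + 1) ∧ ((dj == -[1+ 0 ]) ∧ (+ 1 <= x + x + dx)))
  where
  dx dj : ℤ
  dx = proj₁ (stepOffset t)
  dj = proj₂ (stepOffset t)

above : Offset → ℤ
above (x , j) = 𝟙 (+ 1 <= j)

-- Moving the origin by δ moves the ray: the crossing of e → e ⊕ t changes by the difference of
-- sweep δ at its endpoints, plus its signed crossing with the edge from 0 to δ, edgeCrossing,
-- which only a jump can produce.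
sweep : Dir → Offset → ℤ
sweep NE (x , j) = - 𝟙 ((j == + 1) ∧ (+ 0 <= x))
sweep NW (x , j) = - 𝟙 ((j == + 1) ∧ (+ 0 <= x))
sweep SW (x , j) = 𝟙 ((j == + 0) ∧ (+ 0 <= x))
sweep SE (x , j) = 𝟙 ((j == + 0) ∧ (+ 1 <= x))
sweep E  _ = + 0
sweep W  _ = + 0

edgeCrossing : Dir → Offset → Step → ℤ
edgeCrossing _  _ (move _) = + 0
edgeCrossing NW e jump₋    = - 𝟙 (e ≐ (+ 0 , + 1))
edgeCrossing SE e jump₋    = 𝟙 (e ≐ (+ 1 , + 0))
edgeCrossing NW e jump₊    = 𝟙 (e ≐ (-[1+ 0 ] , + 0))
edgeCrossing SE e jump₊    = - 𝟙 (e ≐ (+ 0 , -[1+ 0 ]))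
edgeCrossing _  _ _        = + 0

touches : Dir → Offset → Bool
touches δ u = (u ≐ (+ 0 , + 0)) ∨ (u ≐ dirOffset δ)

crossingShiftAt : Dir → Step → Offset × Offset × Offset → Bool
crossingShiftAt δ t (u , u⁺ , u⁻) = (touches δ u ∨ touches δ u⁺) ∨
  (crossing u⁻ t == crossing u t + ((sweep δ u⁺ - sweep δ u) + edgeCrossing δ u t))

crossingShiftTest : Dir → Step → Offset → Bool
crossingShiftTest δ t e = crossingShiftAt δ t (clamp e , clamp (e ⊕ stepOffset t) , clamp (e ⊕ ⊝ dirOffset δ))

crossingShiftTest-certificate : T (all² (λ δ t → everywhere (crossingShiftTest δ t)) dirs steps)
crossingShiftTest-certificate = _

crossingShiftTest-clampWindow : ∀ δ t e → crossingShiftTest δ t e ≡ crossingShiftTest δ t (clampWindow e)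
crossingShiftTest-clampWindow δ t e = cong (crossingShiftAt δ t)
  (cong₂ _,_ (clamp-clampWindow e)
    (cong₂ _,_ (clamp-⊕-small e (stepOffset-small t)) (clamp-⊕-small e (⊝dirOffset-small δ))))

clamp-touches : ∀ δ u → T (touches δ (clamp u)) → u ≡ (+ 0 , + 0) ⊎ u ≡ dirOffset δ
clamp-touches δ u p with Equivalence.to T-∨ p
... | inj₁ q = inj₁ (clamp-≐-small u _ (small₀ , small₀) q)
... | inj₂ q = inj₂ (clamp-≐-small u _ (dirOffset-small δ) q)

crossing-shift : ∀ δ t e →
  e ≢ (+ 0 , + 0) → e ≢ dirOffset δ → e ⊕ stepOffset t ≢ (+ 0 , + 0) → e ⊕ stepOffset t ≢ dirOffset δ →
  crossing (clamp (e ⊕ ⊝ dirOffset δ)) t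
    ≡ crossing (clamp e) t
      + ((sweep δ (clamp (e ⊕ stepOffset t)) - sweep δ (clamp e)) + edgeCrossing δ (clamp e) t)
crossing-shift δ t e e≢0 e≢δ e⁺≢0 e⁺≢δ with Equivalence.to T-∨ holds
  where
  holds : T (crossingShiftTest δ t e)
  holds = everywhere-sound (crossingShiftTest δ t) (crossingShiftTest-clampWindow δ t) checked e
    where
    checked : T (everywhere (crossingShiftTest δ t))
    checked = all²-sound (λ δ t → everywhere (crossingShiftTest δ t)) dirs steps
                crossingShiftTest-certificate (∈-dirs δ) (∈-steps t)
... | inj₂ p = ==⇒≡ _ _ p
... | inj₁ p with Equivalence.to T-∨ p
...   | inj₁ q = [ e≢0 , e≢δ ]′ (clamp-touches δ e q) |> ⊥-elim
...   | inj₂ q = [ e⁺≢0 , e⁺≢δ ]′ (clamp-touches δ (e ⊕ stepOffset t) q) |> ⊥-elim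

OffRayRow : ℤ → Set
OffRayRow j = j ≤ -[1+ 0 ] ⊎ + 2 ≤ j

offRay : ℤ → Bool
offRay j = not (j == + 0) ∧ not (j == + 1)

westFlag : Offset → Bool
westFlag (x , j) = offRay j ∨ (x <= -[1+ 0 ])

eastFlag : Offset → Bool
eastFlag (x , j) = offRay j ∨ (+ 1 <= x)

westTest : Step → Offset → Bool
westTest t e = not (westFlag (clamp e)) ∨ (crossing (clamp e) t == + 0)

eastTestAt : Step → Offset × Offset → Bool
eastTestAt t (u , u⁺) = not (eastFlag u) ∨ (crossing u t == above u⁺ - above u)

eastTest : Step → Offset → Bool
eastTest t e = eastTestAt t (clamp e , clamp (e ⊕ stepOffset t))

westTest-certificate : T (all (λ t → everywhere (westTest t)) steps)
westTest-certificate = _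

eastTest-certificate : T (all (λ t → everywhere (eastTest t)) steps)
eastTest-certificate = _

offRay-clamp₃ : ∀ j → OffRayRow j → T (offRay (clamp₃ j))
offRay-clamp₃ -[1+ 0 ] _ = _
offRay-clamp₃ -[1+ 1 ] _ = _
offRay-clamp₃ -[1+ suc (suc n) ] _ = _
offRay-clamp₃ (+ 2) _ = _
offRay-clamp₃ (+ suc (suc (suc n))) _ = _
offRay-clamp₃ (+ 0) (inj₂ (+≤+ ()))
offRay-clamp₃ (+ 1) (inj₂ (+≤+ (s≤s ())))

offRayRow-suc-suc : ∀ n → OffRayRow (+ suc (suc n))
offRayRow-suc-suc n = inj₂ (+≤+ (s≤s (s≤s z≤n)))

offRayRow-neg : ∀ n → OffRayRow -[1+ n ]
offRayRow-neg n = inj₁ (-≤- z≤n)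

clamp₃-west : ∀ x → x ≤ -[1+ 0 ] → T (clamp₃ x <= -[1+ 0 ])
clamp₃-west -[1+ 0 ] _ = _
clamp₃-west -[1+ 1 ] _ = _
clamp₃-west -[1+ suc (suc n) ] _ = _

clamp₃-east : ∀ x → + 1 ≤ x → T (+ 1 <= clamp₃ x)
clamp₃-east (+ 1) _ = _
clamp₃-east (+ 2) _ = _
clamp₃-east (+ suc (suc (suc n))) _ = _
clamp₃-east (+ 0) (+≤+ ())

westFlag-clamp : ∀ x j → OffRayRow j ⊎ a2 (x , j) ≤ -[1+ 0 ] → T (westFlag (clamp (x , j)))
westFlag-clamp x j (inj₁ off) = Equivalence.from T-∨ (inj₁ (offRay-clamp₃ j off))
westFlag-clamp x (+ suc (suc n)) (inj₂ _) = westFlag-clamp x _ (inj₁ (offRayRow-suc-suc n))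
westFlag-clamp x -[1+ n ] (inj₂ _) = westFlag-clamp x _ (inj₁ (offRayRow-neg n))
westFlag-clamp -[1+ n ] (+ 0) (inj₂ _) = Equivalence.from T-∨ (inj₂ (clamp₃-west -[1+ n ] (-≤- z≤n)))
westFlag-clamp -[1+ n ] (+ 1) (inj₂ _) = Equivalence.from T-∨ (inj₂ (clamp₃-west -[1+ n ] (-≤- z≤n)))
westFlag-clamp (+ 0) (+ 0) (inj₂ ())
westFlag-clamp (+ suc n) (+ 0) (inj₂ ())
westFlag-clamp (+ 0) (+ 1) (inj₂ ())
westFlag-clamp (+ suc n) (+ 1) (inj₂ ())

eastFlag-clamp : ∀ x j → OffRayRow j ⊎ + 2 ≤ a2 (x , j) → T (eastFlag (clamp (x , j)))
eastFlag-clamp x j (inj₁ off) = Equivalence.from T-∨ (inj₁ (offRay-clamp₃ j off))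
eastFlag-clamp x (+ suc (suc n)) (inj₂ _) = eastFlag-clamp x _ (inj₁ (offRayRow-suc-suc n))
eastFlag-clamp x -[1+ n ] (inj₂ _) = eastFlag-clamp x _ (inj₁ (offRayRow-neg n))
eastFlag-clamp (+ suc n) (+ 0) (inj₂ _) = Equivalence.from T-∨ (inj₂ (clamp₃-east (+ suc n) (+≤+ (s≤s z≤n))))
eastFlag-clamp (+ suc n) (+ 1) (inj₂ _) = Equivalence.from T-∨ (inj₂ (clamp₃-east (+ suc n) (+≤+ (s≤s z≤n))))
eastFlag-clamp (+ 0) (+ 0) (inj₂ (+≤+ ()))
eastFlag-clamp (+ 0) (+ 1) (inj₂ (+≤+ (s≤s ())))
eastFlag-clamp -[1+ n ] (+ 0) (inj₂ ())
eastFlag-clamp -[1+ 0 ] (+ 1) (inj₂ ())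
eastFlag-clamp -[1+ suc n ] (+ 1) (inj₂ ())

crossing-west : ∀ t e → OffRayRow (row e) ⊎ a2 e ≤ -[1+ 0 ] → crossing (clamp e) t ≡ + 0
crossing-west t e@(x , j) h = ==⇒≡ _ _ (not-∨⇒ holds (westFlag-clamp x j h))
  where
  holds : T (westTest t e)
  holds = everywhere-sound (westTest t) (λ e → cong (λ u → not (westFlag u) ∨ (crossing u t == + 0)) (clamp-clampWindow e))
            (all-sound (λ t → everywhere (westTest t)) steps westTest-certificate (∈-steps t)) e

crossing-east : ∀ t e → OffRayRow (row e) ⊎ + 2 ≤ a2 e →
  crossing (clamp e) t ≡ above (clamp (e ⊕ stepOffset t)) - above (clamp e)
crossing-east t e@(x , j) h = ==⇒≡ _ _ (not-∨⇒ holds (eastFlag-clamp x j h))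
  where
  holds : T (eastTest t e)
  holds = everywhere-sound (eastTest t)
            (λ e → cong (eastTestAt t) (cong₂ _,_ (clamp-clampWindow e) (clamp-⊕-small e (stepOffset-small t))))
            (all-sound (λ t → everywhere (eastTest t)) steps eastTest-certificate (∈-steps t)) e

sweep-far-rows : ∀ δ x → sweep δ (x , -[1+ 2 ]) ≡ + 0 × sweep δ (x , + 3) ≡ + 0
sweep-far-rows E  x = refl , refl
sweep-far-rows NE x = refl , refl
sweep-far-rows NW x = refl , refl
sweep-far-rows W  x = refl , refl
sweep-far-rows SW x = refl , refl
sweep-far-rows SE x = refl , refl

sweep-below : ∀ δ e → row e ≤ -[1+ 2 ] → sweep δ (clamp e) ≡ + 0
sweep-below δ (a , b) b≤-3 rewrite clamp₃-below b b≤-3 = proj₁ (sweep-far-rows δ (clamp₃ a))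

sweep-above : ∀ δ e → + 3 ≤ row e → sweep δ (clamp e) ≡ + 0
sweep-above δ (a , b) 3≤b rewrite clamp₃-above b 3≤b = proj₂ (sweep-far-rows δ (clamp₃ a))

above-below : ∀ e → row e ≤ -[1+ 2 ] → above (clamp e) ≡ + 0
above-below (a , b) b≤-3 rewrite clamp₃-below b b≤-3 = refl

above-above : ∀ e → + 3 ≤ row e → above (clamp e) ≡ + 1
above-above (a , b) 3≤b rewrite clamp₃-above b 3≤b = refl

-- The mirror map θ

reflect : Dir → Dir
reflect E  = E
reflect W  = W
reflect NE = SE
reflect NW = SW
reflect SW = NW
reflect SE = NE

reflect-offset : ∀ δ → dirOffset (reflect δ) ≡ (proj₁ (dirOffset δ) + proj₂ (dirOffset δ) , - proj₂ (dirOffset δ))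
reflect-offset E  = refl
reflect-offset W  = refl
reflect-offset NE = refl
reflect-offset NW = refl
reflect-offset SW = refl
reflect-offset SE = refl

-- θ maps the step of direction δ from a cell of row j to the step mirrorStep δ j; it is a
-- lattice step except when it leaves row -1 to the north-west or row 0 to the south-east.
mirrorStep : Dir → ℤ → Step
mirrorStep NW -[1+ 0 ] = jump₋
mirrorStep NE -[1+ 0 ] = move SW
mirrorStep SE (+ 0)    = jump₊
mirrorStep SW (+ 0)    = move NE
mirrorStep δ  _        = move (reflect δ)

θ-below : ∀ x j → j < + 0 → θ (x , j) ≡ (x + j + + 1 , - + 1 - j)
θ-below x -[1+ n ] _ = refl
θ-below x (+ n) (+<+ ())

θ-above : ∀ x j → + 0 ≤ j → θ (x , j) ≡ (x + j , - + 1 - j)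
θ-above x (+ n) _ = refl

θ-step-below : ∀ x j δ → j < + 0 → j + proj₂ (dirOffset δ) < + 0 →
  θ ((x , j) ⊕ dirOffset δ) ≡ θ (x , j) ⊕ dirOffset (reflect δ)
θ-step-below x j δ j<0 j′<0
  rewrite θ-below (x + proj₁ (dirOffset δ)) (j + proj₂ (dirOffset δ)) j′<0 | θ-below x j j<0
        | reflect-offset δ
  = cong₂ _,_ (shiftˣ x j (proj₁ (dirOffset δ)) (proj₂ (dirOffset δ))) (shiftʲ j (proj₂ (dirOffset δ)))
  where
  shiftˣ : ∀ x j dx dj → x + dx + (j + dj) + + 1 ≡ x + j + + 1 + (dx + dj)
  shiftˣ = solve-∀
  shiftʲ : ∀ j dj → - + 1 - (j + dj) ≡ - + 1 - j + - dj
  shiftʲ = solve-∀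

θ-step-above : ∀ x j δ → + 0 ≤ j → + 0 ≤ j + proj₂ (dirOffset δ) →
  θ ((x , j) ⊕ dirOffset δ) ≡ θ (x , j) ⊕ dirOffset (reflect δ)
θ-step-above x j δ 0≤j 0≤j′
  rewrite θ-above (x + proj₁ (dirOffset δ)) (j + proj₂ (dirOffset δ)) 0≤j′ | θ-above x j 0≤j
        | reflect-offset δ
  = cong₂ _,_ (shiftˣ x j (proj₁ (dirOffset δ)) (proj₂ (dirOffset δ))) (shiftʲ j (proj₂ (dirOffset δ)))
  where
  shiftˣ : ∀ x j dx dj → x + dx + (j + dj) ≡ x + j + (dx + dj)
  shiftˣ = solve-∀
  shiftʲ : ∀ j dj → - + 1 - (j + dj) ≡ - + 1 - j + - dj
  shiftʲ = solve-∀

θ-step : ∀ c δ → θ (c ⊕ dirOffset δ) ≡ θ c ⊕ stepOffset (mirrorStep δ (row c))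
θ-step (x , -[1+ suc n ]) E  = θ-step-below x _ E  -<+ -<+
θ-step (x , -[1+ suc n ]) NE = θ-step-below x _ NE -<+ -<+
θ-step (x , -[1+ suc n ]) NW = θ-step-below x _ NW -<+ -<+
θ-step (x , -[1+ suc n ]) W  = θ-step-below x _ W  -<+ -<+
θ-step (x , -[1+ suc n ]) SW = θ-step-below x _ SW -<+ -<+
θ-step (x , -[1+ suc n ]) SE = θ-step-below x _ SE -<+ -<+
θ-step (x , -[1+ 0 ]) E  = θ-step-below x _ E  -<+ -<+
θ-step (x , -[1+ 0 ]) W  = θ-step-below x _ W  -<+ -<+
θ-step (x , -[1+ 0 ]) SW = θ-step-below x _ SW -<+ -<+
θ-step (x , -[1+ 0 ]) SE = θ-step-below x _ SE -<+ -<+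
θ-step (x , -[1+ 0 ]) NE = cong (_, _) (eq x)
  where
  eq : ∀ x → x + + 0 + + 0 ≡ x + -[1+ 0 ] + + 1 + + 0
  eq = solve-∀
θ-step (x , -[1+ 0 ]) NW = cong (_, _) (eq x)
  where
  eq : ∀ x → x + -[1+ 0 ] + + 0 ≡ x + -[1+ 0 ] + + 1 + -[1+ 0 ]
  eq = solve-∀
θ-step (x , + 0) E  = θ-step-above x _ E  (+≤+ z≤n) (+≤+ z≤n)
θ-step (x , + 0) W  = θ-step-above x _ W  (+≤+ z≤n) (+≤+ z≤n)
θ-step (x , + 0) NE = θ-step-above x _ NE (+≤+ z≤n) (+≤+ z≤n)
θ-step (x , + 0) NW = θ-step-above x _ NW (+≤+ z≤n) (+≤+ z≤n)
θ-step (x , + 0) SW = cong (_, _) (eq x)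
  where
  eq : ∀ x → x + + 0 + -[1+ 0 ] + + 1 ≡ x + + 0 + + 0
  eq = solve-∀
θ-step (x , + 0) SE = cong (_, _) (eq x)
  where
  eq : ∀ x → x + + 1 + -[1+ 0 ] + + 1 ≡ x + + 0 + + 1
  eq = solve-∀
θ-step (x , + suc n) E  = θ-step-above x _ E  (+≤+ z≤n) (+≤+ z≤n)
θ-step (x , + suc n) NE = θ-step-above x _ NE (+≤+ z≤n) (+≤+ z≤n)
θ-step (x , + suc n) NW = θ-step-above x _ NW (+≤+ z≤n) (+≤+ z≤n)
θ-step (x , + suc n) W  = θ-step-above x _ W  (+≤+ z≤n) (+≤+ z≤n)
θ-step (x , + suc n) SW = θ-step-above x _ SW (+≤+ z≤n) (+≤+ z≤n)
θ-step (x , + suc n) SE = θ-step-above x _ SE (+≤+ z≤n) (+≤+ z≤n)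

θ-row : ∀ c → row (θ c) ≡ - + 1 - row c
θ-row (x , + n)    = refl
θ-row (x , -[1+ n ]) = refl

θ-a2-above : ∀ c → + 0 ≤ row c → a2 (θ c) ≡ a2 c - + 1
θ-a2-above (x , j) 0≤j rewrite θ-above x j 0≤j = eq x j
  where
  eq : ∀ x j → + 2 * (x + j) + (- + 1 - j) ≡ + 2 * x + j - + 1
  eq = solve-∀

θ-a2-below : ∀ c → row c < + 0 → a2 (θ c) ≡ a2 c + + 1
θ-a2-below (x , j) j<0 rewrite θ-below x j j<0 = eq x j
  where
  eq : ∀ x j → + 2 * (x + j + + 1) + (- + 1 - j) ≡ + 2 * x + j + + 1
  eq = solve-∀

-- Axis crossings

-- For the image jump of a step of r crossing the axis, axisSign is the direction of the crossing
-- (+1 upwards), and x + axisShift, for the step starting in column x, names the axis edge crossed.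
axisSign : Step → ℤ
axisSign jump₋    = + 1
axisSign jump₊    = -[1+ 0 ]
axisSign (move _) = + 0

axisShift : Step → ℤ
axisShift jump₊ = + 1
axisShift _     = + 0

axisSignAt : Dir → ℤ → ℤ
axisSignAt NW j = 𝟙 (j == -[1+ 0 ])
axisSignAt SE j = - 𝟙 (j == + 0)
axisSignAt _  _ = + 0

axisShiftAt : Dir → ℤ → ℤ
axisShiftAt SE j = 𝟙 (j == + 0)
axisShiftAt _  _ = + 0

axisSign-mirrorStep : ∀ δ j → axisSign (mirrorStep δ j) ≡ axisSignAt δ j
axisSign-mirrorStep E  j = refl
axisSign-mirrorStep W  j = refl
axisSign-mirrorStep NE -[1+ 0 ] = refl
axisSign-mirrorStep NE -[1+ suc n ] = refl
axisSign-mirrorStep NE (+ n) = refl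
axisSign-mirrorStep NW -[1+ 0 ] = refl
axisSign-mirrorStep NW -[1+ suc n ] = refl
axisSign-mirrorStep NW (+ n) = refl
axisSign-mirrorStep SW (+ 0) = refl
axisSign-mirrorStep SW (+ suc n) = refl
axisSign-mirrorStep SW -[1+ n ] = refl
axisSign-mirrorStep SE (+ 0) = refl
axisSign-mirrorStep SE (+ suc n) = refl
axisSign-mirrorStep SE -[1+ n ] = refl

axisShift-mirrorStep : ∀ δ j → axisShift (mirrorStep δ j) ≡ axisShiftAt δ j
axisShift-mirrorStep E  j = refl
axisShift-mirrorStep W  j = refl
axisShift-mirrorStep NE -[1+ 0 ] = refl
axisShift-mirrorStep NE -[1+ suc n ] = refl
axisShift-mirrorStep NE (+ n) = refl
axisShift-mirrorStep NW -[1+ 0 ] = refl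
axisShift-mirrorStep NW -[1+ suc n ] = refl
axisShift-mirrorStep NW (+ n) = refl
axisShift-mirrorStep SW (+ 0) = refl
axisShift-mirrorStep SW (+ suc n) = refl
axisShift-mirrorStep SW -[1+ n ] = refl
axisShift-mirrorStep SE (+ 0) = refl
axisShift-mirrorStep SE (+ suc n) = refl
axisShift-mirrorStep SE -[1+ n ] = refl

mirrorStep-jump₋ : ∀ δ j → mirrorStep δ j ≡ jump₋ → δ ≡ NW × j ≡ -[1+ 0 ]
mirrorStep-jump₋ NW -[1+ 0 ] _ = refl , refl
mirrorStep-jump₋ E  j ()
mirrorStep-jump₋ W  j ()
mirrorStep-jump₋ NE -[1+ 0 ] ()
mirrorStep-jump₋ NE -[1+ suc n ] ()
mirrorStep-jump₋ NE (+ n) ()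
mirrorStep-jump₋ NW -[1+ suc n ] ()
mirrorStep-jump₋ NW (+ n) ()
mirrorStep-jump₋ SW (+ 0) ()
mirrorStep-jump₋ SW (+ suc n) ()
mirrorStep-jump₋ SW -[1+ n ] ()
mirrorStep-jump₋ SE (+ 0) ()
mirrorStep-jump₋ SE (+ suc n) ()
mirrorStep-jump₋ SE -[1+ n ] ()

mirrorStep-jump₊ : ∀ δ j → mirrorStep δ j ≡ jump₊ → δ ≡ SE × j ≡ + 0
mirrorStep-jump₊ SE (+ 0) _ = refl , refl
mirrorStep-jump₊ E  j ()
mirrorStep-jump₊ W  j ()
mirrorStep-jump₊ NE -[1+ 0 ] ()
mirrorStep-jump₊ NE -[1+ suc n ] ()
mirrorStep-jump₊ NE (+ n) ()
mirrorStep-jump₊ NW -[1+ 0 ] ()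
mirrorStep-jump₊ NW -[1+ suc n ] ()
mirrorStep-jump₊ NW (+ n) ()
mirrorStep-jump₊ SW (+ 0) ()
mirrorStep-jump₊ SW (+ suc n) ()
mirrorStep-jump₊ SW -[1+ n ] ()
mirrorStep-jump₊ SE (+ suc n) ()
mirrorStep-jump₊ SE -[1+ n ] ()

edgeCrossing-jump₋ : ∀ x j y δ →
  edgeCrossing δ (clamp ((y + -[1+ 0 ] + + 1 , + 0) ⊖ (x , j))) jump₋
    ≡ - (axisSignAt δ j * + 1 * 𝟙 ((x + axisShiftAt δ j) == (y + + 0)))
edgeCrossing-jump₋ x j y E  = refl
edgeCrossing-jump₋ x j y NE = refl
edgeCrossing-jump₋ x j y W  = refl
edgeCrossing-jump₋ x j y SW = refl
edgeCrossing-jump₋ x j y NW = cong -_ (begin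
  𝟙 (clamp (e₁ , + 0 - j) ≐ (+ 0 , + 1))        ≡⟨ 𝟙-clamp-≐ e₁ (+ 0 - j) small₀ small₊ ⟩
  𝟙 (e₁ == + 0) * 𝟙 (+ 0 - j == + 1)
    ≡⟨ cong₂ _*_ (trans (𝟙-==-diff e₁ (+ 0) (y + + 0) (x + + 0) (eqˣ y x)) (𝟙-==-sym (y + + 0) _))
                 (trans (𝟙-==-diff (+ 0 - j) (+ 1) -[1+ 0 ] j (eqʲ j)) (𝟙-==-sym -[1+ 0 ] j)) ⟩
  𝟙 (x + + 0 == y + + 0) * 𝟙 (j == -[1+ 0 ])     ≡⟨ swap (𝟙 (x + + 0 == y + + 0)) (𝟙 (j == -[1+ 0 ])) ⟩
  𝟙 (j == -[1+ 0 ]) * + 1 * 𝟙 (x + + 0 == y + + 0) ∎)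
  where
  open ≡-Reasoning
  e₁ : ℤ
  e₁ = y + -[1+ 0 ] + + 1 - x
  eqˣ : ∀ y x → (y + -[1+ 0 ] + + 1 - x) - + 0 ≡ (y + + 0) - (x + + 0)
  eqˣ = solve-∀
  eqʲ : ∀ j → (+ 0 - j) - + 1 ≡ -[1+ 0 ] - j
  eqʲ = solve-∀
  swap : ∀ a b → a * b ≡ b * + 1 * a
  swap = solve-∀
edgeCrossing-jump₋ x j y SE with j ℤ.≟ + 0
... | yes refl = begin
  𝟙 (clamp (e₁ , + 0 - + 0) ≐ (+ 1 , + 0))      ≡⟨ 𝟙-clamp-≐ e₁ (+ 0 - + 0) small₊ small₀ ⟩
  𝟙 (e₁ == + 1) * + 1
    ≡⟨ cong (_* + 1) (trans (𝟙-==-diff e₁ (+ 1) (y + + 0) (x + + 1) (eqˣ y x)) (𝟙-==-sym (y + + 0) _)) ⟩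
  𝟙 (x + + 1 == y + + 0) * + 1                  ≡⟨ eq (𝟙 (x + + 1 == y + + 0)) ⟩
  - (- + 1 * + 1 * 𝟙 (x + + 1 == y + + 0))      ∎
  where
  open ≡-Reasoning
  e₁ : ℤ
  e₁ = y + -[1+ 0 ] + + 1 - x
  eqˣ : ∀ y x → (y + -[1+ 0 ] + + 1 - x) - + 1 ≡ (y + + 0) - (x + + 1)
  eqˣ = solve-∀
  eq : ∀ a → a * + 1 ≡ - (- + 1 * + 1 * a)
  eq = solve-∀
... | no j≢0 = begin
  𝟙 (clamp (e₁ , + 0 - j) ≐ (+ 1 , + 0))        ≡⟨ 𝟙-clamp-≐ e₁ (+ 0 - j) small₊ small₀ ⟩
  𝟙 (e₁ == + 1) * 𝟙 (+ 0 - j == + 0)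
    ≡⟨ cong (𝟙 (e₁ == + 1) *_) (trans (𝟙-==-diff (+ 0 - j) (+ 0) (+ 0) j (eqʲ j))
                                      (cong 𝟙 (dec-false (+ 0 ℤ.≟ j) (j≢0 ∘ sym)))) ⟩
  𝟙 (e₁ == + 1) * + 0                            ≡⟨ ℤP.*-zeroʳ (𝟙 (e₁ == + 1)) ⟩
  + 0 ∎
  where
  open ≡-Reasoning
  e₁ : ℤ
  e₁ = y + -[1+ 0 ] + + 1 - x
  eqʲ : ∀ j → (+ 0 - j) - + 0 ≡ + 0 - j
  eqʲ = solve-∀

edgeCrossing-jump₊ : ∀ x j y δ →
  edgeCrossing δ (clamp ((y + + 0 , -[1+ 0 ]) ⊖ (x , j))) jump₊
    ≡ - (axisSignAt δ j * -[1+ 0 ] * 𝟙 ((x + axisShiftAt δ j) == (y + + 1)))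
edgeCrossing-jump₊ x j y E  = refl
edgeCrossing-jump₊ x j y NE = refl
edgeCrossing-jump₊ x j y W  = refl
edgeCrossing-jump₊ x j y SW = refl
edgeCrossing-jump₊ x j y NW = begin
  𝟙 (clamp (e₁ , -[1+ 0 ] - j) ≐ (-[1+ 0 ] , + 0))   ≡⟨ 𝟙-clamp-≐ e₁ (-[1+ 0 ] - j) small₋ small₀ ⟩
  𝟙 (e₁ == -[1+ 0 ]) * 𝟙 (-[1+ 0 ] - j == + 0)
    ≡⟨ cong₂ _*_ (trans (𝟙-==-diff e₁ -[1+ 0 ] (y + + 1) (x + + 0) (eqˣ y x)) (𝟙-==-sym (y + + 1) _))
                 (trans (𝟙-==-diff (-[1+ 0 ] - j) (+ 0) -[1+ 0 ] j (eqʲ j)) (𝟙-==-sym -[1+ 0 ] j)) ⟩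
  𝟙 (x + + 0 == y + + 1) * 𝟙 (j == -[1+ 0 ])         ≡⟨ swap (𝟙 (x + + 0 == y + + 1)) (𝟙 (j == -[1+ 0 ])) ⟩
  - (𝟙 (j == -[1+ 0 ]) * -[1+ 0 ] * 𝟙 (x + + 0 == y + + 1)) ∎
  where
  open ≡-Reasoning
  e₁ : ℤ
  e₁ = y + + 0 - x
  eqˣ : ∀ y x → (y + + 0 - x) - -[1+ 0 ] ≡ (y + + 1) - (x + + 0)
  eqˣ = solve-∀
  eqʲ : ∀ j → (-[1+ 0 ] - j) - + 0 ≡ -[1+ 0 ] - j
  eqʲ = solve-∀
  swap : ∀ a b → a * b ≡ - (b * -[1+ 0 ] * a)
  swap = solve-∀
edgeCrossing-jump₊ x j y SE with j ℤ.≟ + 0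
... | yes refl = begin
  - 𝟙 (clamp (e₁ , -[1+ 0 ] - + 0) ≐ (+ 0 , -[1+ 0 ]))   ≡⟨ cong -_ (𝟙-clamp-≐ e₁ (-[1+ 0 ] - + 0) small₀ small₋) ⟩
  - (𝟙 (e₁ == + 0) * + 1)
    ≡⟨ cong (λ z → - (z * + 1)) (trans (𝟙-==-diff e₁ (+ 0) (y + + 1) (x + + 1) (eqˣ y x)) (𝟙-==-sym (y + + 1) _)) ⟩
  - (𝟙 (x + + 1 == y + + 1) * + 1)                       ≡⟨ eq (𝟙 (x + + 1 == y + + 1)) ⟩
  - (- + 1 * -[1+ 0 ] * 𝟙 (x + + 1 == y + + 1))          ∎
  where
  open ≡-Reasoning
  e₁ : ℤ
  e₁ = y + + 0 - x
  eqˣ : ∀ y x → (y + + 0 - x) - + 0 ≡ (y + + 1) - (x + + 1)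
  eqˣ = solve-∀
  eq : ∀ a → - (a * + 1) ≡ - (- + 1 * -[1+ 0 ] * a)
  eq = solve-∀
... | no j≢0 = cong -_ (begin
  𝟙 (clamp (e₁ , -[1+ 0 ] - j) ≐ (+ 0 , -[1+ 0 ]))   ≡⟨ 𝟙-clamp-≐ e₁ (-[1+ 0 ] - j) small₀ small₋ ⟩
  𝟙 (e₁ == + 0) * 𝟙 (-[1+ 0 ] - j == -[1+ 0 ])
    ≡⟨ cong (𝟙 (e₁ == + 0) *_) (trans (𝟙-==-diff (-[1+ 0 ] - j) -[1+ 0 ] (+ 0) j (eqʲ j))
                                      (cong 𝟙 (dec-false (+ 0 ℤ.≟ j) (j≢0 ∘ sym)))) ⟩
  𝟙 (e₁ == + 0) * + 0                                ≡⟨ ℤP.*-zeroʳ (𝟙 (e₁ == + 0)) ⟩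
  + 0 ∎)
  where
  open ≡-Reasoning
  e₁ : ℤ
  e₁ = y + + 0 - x
  eqʲ : ∀ j → (-[1+ 0 ] - j) - -[1+ 0 ] ≡ + 0 - j
  eqʲ = solve-∀

edgeCrossing-θ : ∀ c d δ δ′ →
  edgeCrossing δ (clamp (θ d ⊖ c)) (mirrorStep δ′ (row d))
    ≡ - (axisSign (mirrorStep δ (row c)) * axisSign (mirrorStep δ′ (row d))
         * 𝟙 ((proj₁ c + axisShift (mirrorStep δ (row c))) == (proj₁ d + axisShift (mirrorStep δ′ (row d)))))
edgeCrossing-θ (x , j) (y , i) δ δ′ with mirrorStep δ′ i in eq
... | move _ = sym (-[a*0*b]≡0 (axisSign (mirrorStep δ j)) _)
  where
  -[a*0*b]≡0 : ∀ a b → - (a * + 0 * b) ≡ + 0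
  -[a*0*b]≡0 a b = cong -_ (trans (cong (_* b) (ℤP.*-zeroʳ a)) (ℤP.*-zeroˡ b))
... | jump₋ with mirrorStep-jump₋ δ′ i eq
...   | refl , refl rewrite axisSign-mirrorStep δ j | axisShift-mirrorStep δ j = edgeCrossing-jump₋ x j y δ
edgeCrossing-θ (x , j) (y , i) δ δ′ | jump₊ with mirrorStep-jump₊ δ′ i eq
...   | refl , refl rewrite axisSign-mirrorStep δ j | axisShift-mirrorStep δ j = edgeCrossing-jump₊ x j y δ

axisSign-off-axis : ∀ c δ → row c ≢ + 0 → row (c ⊕ dirOffset δ) ≢ + 0 → axisSign (mirrorStep δ (row c)) ≡ + 0
axisSign-off-axis c@(x , j) δ j≢0 j′≢0 = trans (axisSign-mirrorStep δ j) (at δ j′≢0)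
  where
  at : ∀ δ → j + proj₂ (dirOffset δ) ≢ + 0 → axisSignAt δ j ≡ + 0
  at E  _ = refl
  at NE _ = refl
  at W  _ = refl
  at SW _ = refl
  at NW j′≢0 with j ℤ.≟ -[1+ 0 ]
  ... | yes refl = ⊥-elim (j′≢0 refl)
  ... | no _     = refl
  at SE _ with j ℤ.≟ + 0
  ... | yes j≡0 = ⊥-elim (j≢0 j≡0)
  ... | no _    = refl

-- The crossing number of the mirrored chain

-- crossingNumber K c counts the signed crossings of the steps of β with index in [-K, K) with
-- the ray from c.
module MirroredChain (r : ℤ → Cell) (adj : ∀ n → Adjacent (r n) (r (n + + 1))) (disjoint : ∀ n k → θ (r k) ≢ r n) where

  β : ℤ → Cell
  β k = θ (r k)

  dir : ℤ → Dir
  dir n = proj₁ (adjacent-dir (r n) (r (n + + 1)) (adj n))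

  r-step : ∀ n → r (n + + 1) ≡ r n ⊕ dirOffset (dir n)
  r-step n = proj₂ (adjacent-dir (r n) (r (n + + 1)) (adj n))

  τ : ℤ → Step
  τ n = mirrorStep (dir n) (row (r n))

  β-step : ∀ n → β (n + + 1) ≡ β n ⊕ stepOffset (τ n)
  β-step n = trans (cong θ (r-step n)) (θ-step (r n) (dir n))

  crossing-r-step : ∀ n k →
    crossing (clamp (β k ⊖ r (n + + 1))) (τ k)
      ≡ crossing (clamp (β k ⊖ r n)) (τ k)
        + ((sweep (dir n) (clamp (β (k + + 1) ⊖ r n)) - sweep (dir n) (clamp (β k ⊖ r n)))
           + edgeCrossing (dir n) (clamp (β k ⊖ r n)) (τ k))
  crossing-r-step n k = begin
    crossing (clamp (β k ⊖ r (n + + 1))) (τ k)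
      ≡⟨ cong (λ c → crossing (clamp (β k ⊖ c)) (τ k)) (r-step n) ⟩
    crossing (clamp (β k ⊖ (r n ⊕ dirOffset δ))) (τ k)
      ≡⟨ cong (λ v → crossing (clamp v) (τ k)) (⊖-⊕ˡ (β k) (r n) (dirOffset δ)) ⟩
    crossing (clamp (e ⊕ ⊝ dirOffset δ)) (τ k)
      ≡⟨ crossing-shift δ (τ k) e e≢0 e≢δ e⁺≢0 e⁺≢δ ⟩
    crossing (clamp e) (τ k) + ((sweep δ (clamp (e ⊕ stepOffset (τ k))) - sweep δ (clamp e)) + edgeCrossing δ (clamp e) (τ k))
      ≡⟨ cong (λ v → crossing (clamp e) (τ k) + ((sweep δ (clamp v) - sweep δ (clamp e)) + edgeCrossing δ (clamp e) (τ k)))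
              (sym β⁺⊖r) ⟩
    crossing (clamp e) (τ k) + ((sweep δ (clamp (β (k + + 1) ⊖ r n)) - sweep δ (clamp e)) + edgeCrossing δ (clamp e) (τ k)) ∎
    where
    open ≡-Reasoning
    δ : Dir
    δ = dir n
    e : Offset
    e = β k ⊖ r n
    -- Disjointness of r and β enters here: β k and β (k + 1) avoid both r n and r (n + 1).
    β⁺⊖r : β (k + + 1) ⊖ r n ≡ e ⊕ stepOffset (τ k)
    β⁺⊖r = trans (cong (_⊖ r n) (β-step k)) (⊖-⊕ʳ (β k) (stepOffset (τ k)) (r n))
    e≢0 : e ≢ (+ 0 , + 0)
    e≢0 eq = disjoint n k (⊖≡0⇒≡ _ _ eq)
    e≢δ : e ≢ dirOffset δ
    e≢δ eq = disjoint (n + + 1) k (trans (⊖≡⇒≡⊕ _ _ _ eq) (sym (r-step n)))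
    e⁺≢0 : e ⊕ stepOffset (τ k) ≢ (+ 0 , + 0)
    e⁺≢0 eq = disjoint n (k + + 1) (⊖≡0⇒≡ _ _ (trans β⁺⊖r eq))
    e⁺≢δ : e ⊕ stepOffset (τ k) ≢ dirOffset δ
    e⁺≢δ eq = disjoint (n + + 1) (k + + 1) (trans (⊖≡⇒≡⊕ _ _ _ (trans β⁺⊖r eq)) (sym (r-step n)))

  axisSignOf : ℤ → ℤ
  axisSignOf n = axisSign (τ n)

  axisEdgeOf : ℤ → ℤ
  axisEdgeOf n = proj₁ (r n) + axisShift (τ n)

  crossingNumber : ℕ → Cell → ℤ
  crossingNumber K c = sumCentred (λ k → crossing (clamp (β k ⊖ c)) (τ k)) K

  boundarySweep : ℕ → ℤ → ℤ
  boundarySweep K n = sweep (dir n) (clamp (β (+ K) ⊖ r n)) - sweep (dir n) (clamp (β (- + K) ⊖ r n))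

  crossingNumber-r-step : ∀ K n →
    crossingNumber K (r (n + + 1))
      ≡ crossingNumber K (r n) + (boundarySweep K n - sumCentred (λ k → axisSignOf n * axisSignOf k * 𝟙 (axisEdgeOf n == axisEdgeOf k)) K)
  crossingNumber-r-step K n = begin
    crossingNumber K (r (n + + 1))
      ≡⟨ sum-cong′ _ _ (- + K) (K ℕ.+ K) (crossing-r-step n) ⟩
    sumCentred (λ k → w k + (s (k + + 1) - s k + x k)) K
      ≡⟨ sum-distrib-+ w (λ k → s (k + + 1) - s k + x k) (- + K) (K ℕ.+ K) ⟩
    crossingNumber K (r n) + sumCentred (λ k → s (k + + 1) - s k + x k) K
      ≡⟨ cong (_+_ (crossingNumber K (r n))) (sum-distrib-+ (λ k → s (k + + 1) - s k) x (- + K) (K ℕ.+ K)) ⟩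
    crossingNumber K (r n) + (sumCentred (λ k → s (k + + 1) - s k) K + sumCentred x K)
      ≡⟨ cong₂ (λ a b → crossingNumber K (r n) + (a + b)) (sumCentred-telescope s K) edge-sum ⟩
    crossingNumber K (r n) + (boundarySweep K n - sumCentred (λ k → axisSignOf n * axisSignOf k * 𝟙 (axisEdgeOf n == axisEdgeOf k)) K) ∎
    where
    open ≡-Reasoning
    w s x : ℤ → ℤ
    w k = crossing (clamp (β k ⊖ r n)) (τ k)
    s k = sweep (dir n) (clamp (β k ⊖ r n))
    x k = edgeCrossing (dir n) (clamp (β k ⊖ r n)) (τ k)
    edge-sum : sumCentred x K ≡ - sumCentred (λ k → axisSignOf n * axisSignOf k * 𝟙 (axisEdgeOf n == axisEdgeOf k)) K
    edge-sum = trans (sum-cong′ _ _ (- + K) (K ℕ.+ K) (λ k → edgeCrossing-θ (r n) (r k) (dir n) (dir k)))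
                     (sum-neg _ (- + K) (K ℕ.+ K))

  crossingNumber-change : ∀ m d →
    (∀ i → i ℕ.< m ℕ.+ m → boundarySweep (m ℕ.+ d) (- + m + + i) ≡ + 0) →
    (∀ k → k < - + m ⊎ + m ≤ k → axisSignOf k ≡ + 0) →
    crossingNumber (m ℕ.+ d) (r (+ m)) - crossingNumber (m ℕ.+ d) (r (- + m))
      ≡ - coincidences axisSignOf axisEdgeOf (- + m) (m ℕ.+ m)
  crossingNumber-change m d sweeps≡0 outside≡0 = begin
    N (r (+ m)) - N (r (- + m))
      ≡⟨ sym (sumCentred-telescope (λ n → N (r n)) m) ⟩
    sumCentred (λ n → N (r (n + + 1)) - N (r n)) m
      ≡⟨ sum-cong _ _ (- + m) (m ℕ.+ m) step ⟩
    sumCentred (λ n → - sumCentred (coincidence n) K) m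
      ≡⟨ sum-cong′ _ _ (- + m) (m ℕ.+ m) (λ n → cong -_ (sumCentred-extend (coincidence n) m d (outside n))) ⟩
    sumCentred (λ n → - sumCentred (coincidence n) m) m
      ≡⟨ sum-neg _ (- + m) (m ℕ.+ m) ⟩
    - coincidences axisSignOf axisEdgeOf (- + m) (m ℕ.+ m) ∎
    where
    open ≡-Reasoning
    K : ℕ
    K = m ℕ.+ d
    N : Cell → ℤ
    N = crossingNumber K
    coincidence : ℤ → ℤ → ℤ
    coincidence n k = axisSignOf n * axisSignOf k * 𝟙 (axisEdgeOf n == axisEdgeOf k)
    step : ∀ i → i ℕ.< m ℕ.+ m → N (r (- + m + + i + + 1)) - N (r (- + m + + i)) ≡ - sumCentred (coincidence (- + m + + i)) K
    step i i<2m = begin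
      N (r (n + + 1)) - N (r n)
        ≡⟨ cong (_- N (r n)) (crossingNumber-r-step K n) ⟩
      N (r n) + (boundarySweep K n - sumCentred (coincidence n) K) - N (r n)
        ≡⟨ cong (λ b → N (r n) + (b - sumCentred (coincidence n) K) - N (r n)) (sweeps≡0 i i<2m) ⟩
      N (r n) + (+ 0 - sumCentred (coincidence n) K) - N (r n)
        ≡⟨ cancel (N (r n)) (sumCentred (coincidence n) K) ⟩
      - sumCentred (coincidence n) K ∎
      where
      n : ℤ
      n = - + m + + i
      cancel : ∀ a b → a + (+ 0 - b) - a ≡ - b
      cancel = solve-∀
    outside : ∀ n k → k < - + m ⊎ + m ≤ k → coincidence n k ≡ + 0
    outside n k k∉ rewrite outside≡0 k k∉ | ℤP.*-zeroʳ (axisSignOf n) = ℤP.*-zeroˡ (𝟙 (axisEdgeOf n == axisEdgeOf k))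

-- Mirrored plays and winning chains

θ-of-red-is-not-red : ∀ p → Legal p → FollowsMirror p → ∀ {c c′} → MarkedRed p c → MarkedRed p c′ → θ c ≢ c′
θ-of-red-is-not-red p legal mirror (b , refl) (a , refl) θc≡c′ =
  ℕP.even≢odd a b (sym (legal (trans (mirror b) θc≡c′)))

module WinningChain (r : ℤ → Cell) (win : RedWinning r) where

  eventually-NE : ∀ h {N} → proj₁ (win h) ℕ.≤ N → ∀ k → + N ≤ k → a2 (r k) > a2 h × row (r k) > row h
  eventually-NE h M≤N k N≤k with ≥-pos-form k _ N≤k
  ... | n , N≤n , refl = proj₁ (proj₂ (win h) n (ℕP.≤-trans M≤N N≤n))

  eventually-SW : ∀ h {N} → proj₁ (win h) ℕ.≤ N → ∀ k → k ≤ - + N → a2 (r k) < a2 h × row (r k) < row h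
  eventually-SW h M≤N k k≤-N with ≤-neg-form k _ k≤-N
  ... | n , N≤n , refl = proj₂ (proj₂ (win h) n (ℕP.≤-trans M≤N N≤n))

  origin : Cell
  origin = (+ 0 , + 0)

  M₀ : ℕ
  M₀ = proj₁ (win origin)

  S : ℤ
  S = sumAbs (λ k → a2 (r k)) (- + M₀) (M₀ ℕ.+ M₀)

  0≤S : + 0 ≤ S
  0≤S = sumAbs-nonneg (λ k → a2 (r k)) (- + M₀) (M₀ ℕ.+ M₀)

  a2-bounds : ∀ k → (+ 0 ≤ row (r k) → - S ≤ a2 (r k)) × (row (r k) < + 0 → a2 (r k) ≤ S)
  a2-bounds k with + M₀ ℤ.≤? k | - + M₀ ℤ.<? k
  ... | yes M₀≤k | _ = (λ _ → ℤP.≤-trans (ℤP.neg-mono-≤ 0≤S) (ℤP.<⇒≤ (proj₁ tail)))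
                     , (λ row<0 → ⊥-elim (ℤP.<-asym row<0 (proj₂ tail)))
    where
    tail : a2 (r k) > + 0 × row (r k) > + 0
    tail = eventually-NE origin ℕP.≤-refl k M₀≤k
  ... | no _ | no k≮-M₀ = (λ 0≤row → ⊥-elim (ℤP.<-irrefl refl (ℤP.≤-<-trans 0≤row (proj₂ tail))))
                        , (λ _ → ℤP.≤-trans (ℤP.<⇒≤ (proj₁ tail)) 0≤S)
    where
    tail : a2 (r k) < + 0 × row (r k) < + 0
    tail = eventually-SW origin ℕP.≤-refl k (ℤP.≮⇒≥ k≮-M₀)
  ... | no M₀≰k | yes -M₀<k with window-index M₀ k (ℤP.<⇒≤ -M₀<k) (ℤP.≰⇒> M₀≰k)
  ...   | i , i<2M₀ , refl = (λ _ → proj₁ bounds) , (λ _ → proj₂ bounds)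
    where
    bounds : - S ≤ a2 (r (- + M₀ + + i)) × a2 (r (- + M₀ + + i)) ≤ S
    bounds = term-within-sumAbs (λ k → a2 (r k)) (- + M₀) (M₀ ℕ.+ M₀) i i<2M₀

module NoWinningMirroredChain
  (r : ℤ → Cell) (adj : ∀ n → Adjacent (r n) (r (n + + 1)))
  (disjoint : ∀ n k → θ (r k) ≢ r n) (win : RedWinning r) where

  open MirroredChain r adj disjoint
  open WinningChain r win

  -- From r (+ m), east of hE, the chain β stays beside the ray, and from r (- m), west of hW,
  -- it crosses the ray once; K puts β (± K) more than three rows beyond every r n, |n| ≤ m.
  hE hW : Cell
  hE = (S + + 1 , + 1)
  hW = (- (S + + 1) , -[1+ 1 ])

  m : ℕ
  m = suc (M₀ ℕ.+ (proj₁ (win hE) ℕ.+ proj₁ (win hW)))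

  NE-end SW-end : Cell
  NE-end = r (+ m)
  SW-end = r (- + m)

  NE-end-far : a2 NE-end > a2 hE × row NE-end > + 1
  NE-end-far = eventually-NE hE (ℕP.≤-trans (ℕP.≤-trans (ℕP.m≤m+n _ _) (ℕP.m≤n+m _ M₀)) (ℕP.n≤1+n _)) (+ m) ℤP.≤-refl

  SW-end-far : a2 SW-end < a2 hW × row SW-end < -[1+ 1 ]
  SW-end-far = eventually-SW hW (ℕP.≤-trans (ℕP.≤-trans (ℕP.m≤n+m _ _) (ℕP.m≤n+m _ M₀)) (ℕP.n≤1+n _)) (- + m) ℤP.≤-refl

  S₂ : ℤ
  S₂ = sumAbs (λ n → row (r n)) (- + m) (m ℕ.+ m)

  hN hS : Cell
  hN = (+ 0 , S₂ + + 3)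
  hS = (+ 0 , - (S₂ + + 3))

  K : ℕ
  K = m ℕ.+ (proj₁ (win hN) ℕ.+ proj₁ (win hS))

  row-far-N : row (r (+ K)) > S₂ + + 3
  row-far-N = proj₂ (eventually-NE hN (ℕP.≤-trans (ℕP.m≤m+n _ _) (ℕP.m≤n+m _ m)) (+ K) ℤP.≤-refl)

  row-far-S : row (r (- + K)) < - (S₂ + + 3)
  row-far-S = proj₂ (eventually-SW hS (ℕP.≤-trans (ℕP.m≤n+m _ _) (ℕP.m≤n+m _ m)) (- + K) ℤP.≤-refl)

  row-β⊖ : ∀ k c → row (β k ⊖ c) ≡ (- + 1 - row (r k)) - row c
  row-β⊖ k c = trans (row-⊖ (β k) c) (cong (_- row c) (θ-row (r k)))

  row-in-window : ∀ i → i ℕ.< m ℕ.+ m → - S₂ ≤ row (r (- + m + + i)) × row (r (- + m + + i)) ≤ S₂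
  row-in-window = term-within-sumAbs (λ n → row (r n)) (- + m) (m ℕ.+ m)

  β-far-below : ∀ i → i ℕ.< m ℕ.+ m → row (β (+ K) ⊖ r (- + m + + i)) ≤ -[1+ 2 ]
  β-far-below i i<2m = ≤-from-diff _ _ (subst (+ 0 ≤_) (trans (eq (row (r (+ K))) (row n) S₂) (cong (_-_ -[1+ 2 ]) (sym (row-β⊖ (+ K) n))))
    (ℤP.+-mono-≤ (ℤP.+-mono-≤ (diff-1-nonneg row-far-N) (diff-nonneg (proj₁ (row-in-window i i<2m)))) (+≤+ z≤n)))
    where
    n : Cell
    n = r (- + m + + i)
    eq : ∀ Rk Rn S₂ → (Rk - (S₂ + + 3) - + 1) + (Rn - - S₂) + + 2 ≡ -[1+ 2 ] - ((- + 1 - Rk) - Rn)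
    eq = solve-∀

  β-far-above : ∀ i → i ℕ.< m ℕ.+ m → + 3 ≤ row (β (- + K) ⊖ r (- + m + + i))
  β-far-above i i<2m = ≤-from-diff _ _ (subst (+ 0 ≤_) (trans (eq (row (r (- + K))) (row n) S₂) (cong (_- + 3) (sym (row-β⊖ (- + K) n))))
    (ℤP.+-mono-≤ (diff-1-nonneg row-far-S) (diff-nonneg (proj₂ (row-in-window i i<2m)))))
    where
    n : Cell
    n = r (- + m + + i)
    eq : ∀ Rk Rn S₂ → (- (S₂ + + 3) - Rk - + 1) + (S₂ - Rn) ≡ ((- + 1 - Rk) - Rn) - + 3
    eq = solve-∀

  NE-end-west : ∀ k → OffRayRow (row (β k ⊖ NE-end)) ⊎ a2 (β k ⊖ NE-end) ≤ -[1+ 0 ]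
  NE-end-west k with + 0 ℤ.≤? row (r k)
  ... | yes 0≤row = inj₁ (inj₁ (≤-from-diff _ _
        (subst (+ 0 ≤_) (trans (eq (row (r k)) (row NE-end)) (cong (_-_ -[1+ 0 ]) (sym (row-β⊖ k NE-end))))
               (ℤP.+-mono-≤ 0≤row (ℤP.<⇒≤ (ℤP.≤-<-trans (+≤+ z≤n) (proj₂ NE-end-far)))))))
    where
    eq : ∀ Rk Rc → Rk + Rc ≡ -[1+ 0 ] - ((- + 1 - Rk) - Rc)
    eq = solve-∀
  ... | no row≱0 = inj₂ (≤-from-diff _ _
        (subst (+ 0 ≤_) (trans (eq (a2 (r k)) (a2 NE-end) S)
                               (cong (λ z → -[1+ 0 ] - (z - a2 NE-end)) (sym (θ-a2-below (r k) (ℤP.≰⇒> row≱0)))))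
               (ℤP.+-mono-≤ (ℤP.+-mono-≤ (diff-1-nonneg (proj₁ NE-end-far))
                                         (diff-nonneg (proj₂ (a2-bounds k) (ℤP.≰⇒> row≱0))))
                            (ℤP.+-mono-≤ 0≤S (+≤+ z≤n))))
        |> subst (_≤ -[1+ 0 ]) (sym (a2-⊖ (β k) NE-end)))
    where
    eq : ∀ A C S → (C - (+ 2 * (S + + 1) + + 1) - + 1) + (S - A) + (S + + 2) ≡ -[1+ 0 ] - ((A + + 1) - C)
    eq = solve-∀

  crossingNumber-NE-end : crossingNumber K NE-end ≡ + 0
  crossingNumber-NE-end = sum-zero (λ k → crossing (clamp (β k ⊖ NE-end)) (τ k)) (- + K) (K ℕ.+ K)
    (λ i _ → crossing-west (τ (- + K + + i)) (β (- + K + + i) ⊖ NE-end) (NE-end-west (- + K + + i)))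

  SW-end-east : ∀ k → OffRayRow (row (β k ⊖ SW-end)) ⊎ + 2 ≤ a2 (β k ⊖ SW-end)
  SW-end-east k with + 0 ℤ.≤? row (r k)
  ... | yes 0≤row = inj₂ (≤-from-diff _ _
        (subst (+ 0 ≤_) (trans (eq (a2 (r k)) (a2 SW-end) S)
                               (cong (λ z → (z - a2 SW-end) - + 2) (sym (θ-a2-above (r k) 0≤row))))
               (ℤP.+-mono-≤ (ℤP.+-mono-≤ (diff-nonneg (proj₁ (a2-bounds k) 0≤row))
                                         (diff-1-nonneg (proj₁ SW-end-far)))
                            (ℤP.+-mono-≤ 0≤S (+≤+ z≤n))))
        |> subst (+ 2 ≤_) (sym (a2-⊖ (β k) SW-end)))
    where
    eq : ∀ A C S → (A - - S) + ((+ 2 * - (S + + 1) + -[1+ 1 ]) - C - + 1) + (S + + 2) ≡ ((A - + 1) - C) - + 2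
    eq = solve-∀
  ... | no row≱0 = inj₁ (inj₂ (≤-from-diff _ _
        (subst (+ 0 ≤_) (trans (eq (row (r k)) (row SW-end)) (cong (_- + 2) (sym (row-β⊖ k SW-end))))
               (ℤP.+-mono-≤ (ℤP.+-mono-≤ (diff-1-nonneg (ℤP.≰⇒> row≱0)) (diff-1-nonneg (proj₂ SW-end-far)))
                            (+≤+ z≤n)))))
    where
    eq : ∀ Rk Rc → (+ 0 - Rk - + 1) + (-[1+ 1 ] - Rc - + 1) + + 1 ≡ ((- + 1 - Rk) - Rc) - + 2
    eq = solve-∀

  crossingNumber-SW-end : crossingNumber K SW-end ≡ -[1+ 0 ]
  crossingNumber-SW-end = begin
    crossingNumber K SW-end
      ≡⟨ sum-cong′ (λ k → crossing (clamp (β k ⊖ SW-end)) (τ k)) _ (- + K) (K ℕ.+ K) telescopic ⟩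
    sumCentred (λ k → g (k + + 1) - g k) K
      ≡⟨ sumCentred-telescope g K ⟩
    g (+ K) - g (- + K)
      ≡⟨ cong₂ _-_ (above-below (β (+ K) ⊖ SW-end) far-below) (above-above (β (- + K) ⊖ SW-end) far-above) ⟩
    -[1+ 0 ] ∎
    where
    open ≡-Reasoning
    g : ℤ → ℤ
    g k = above (clamp (β k ⊖ SW-end))
    telescopic : ∀ k → crossing (clamp (β k ⊖ SW-end)) (τ k) ≡ g (k + + 1) - g k
    telescopic k = trans (crossing-east (τ k) (β k ⊖ SW-end) (SW-end-east k))
      (cong (λ v → above (clamp v) - g k)
            (sym (trans (cong (_⊖ SW-end) (β-step k)) (⊖-⊕ʳ (β k) (stepOffset (τ k)) SW-end))))
    SW-end≡ : r (- + m + + 0) ≡ SW-end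
    SW-end≡ = cong r (ℤP.+-identityʳ (- + m))
    far-below : row (β (+ K) ⊖ SW-end) ≤ -[1+ 2 ]
    far-below = subst (λ c → row (β (+ K) ⊖ c) ≤ -[1+ 2 ]) SW-end≡ (β-far-below 0 (s≤s z≤n))
    far-above : + 3 ≤ row (β (- + K) ⊖ SW-end)
    far-above = subst (λ c → + 3 ≤ row (β (- + K) ⊖ c)) SW-end≡ (β-far-above 0 (s≤s z≤n))

  boundarySweep-window : ∀ i → i ℕ.< m ℕ.+ m → boundarySweep K (- + m + + i) ≡ + 0
  boundarySweep-window i i<2m =
    cong₂ _-_ (sweep-below (dir n) (β (+ K) ⊖ r n) (β-far-below i i<2m))
              (sweep-above (dir n) (β (- + K) ⊖ r n) (β-far-above i i<2m))
    where
    n : ℤ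
    n = - + m + + i

  M₀≤m : M₀ ℕ.≤ m
  M₀≤m = ℕP.≤-trans (ℕP.m≤m+n M₀ _) (ℕP.n≤1+n _)

  axisSign-outside : ∀ k → k < - + m ⊎ + m ≤ k → axisSignOf k ≡ + 0
  axisSign-outside k k∉ =
    axisSign-off-axis (r k) (dir k) (row≢0 (outside-k k∉)) (subst (λ c → row c ≢ + 0) (r-step k) (row≢0 (outside-k+1 k∉)))
    where
    outside-k : k < - + m ⊎ + m ≤ k → k ≤ - + m ⊎ + m ≤ k
    outside-k (inj₁ k<-m) = inj₁ (ℤP.<⇒≤ k<-m)
    outside-k (inj₂ m≤k)  = inj₂ m≤k
    outside-k+1 : k < - + m ⊎ + m ≤ k → k + + 1 ≤ - + m ⊎ + m ≤ k + + 1
    outside-k+1 (inj₁ k<-m) = inj₁ (subst (_≤ - + m) (ℤP.+-comm (+ 1) k) (ℤP.i<j⇒suc[i]≤j k<-m))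
    outside-k+1 (inj₂ m≤k)  = inj₂ (ℤP.≤-trans m≤k (ℤP.i≤i+j k (+ 1)))
    row≢0 : ∀ {k} → k ≤ - + m ⊎ + m ≤ k → row (r k) ≢ + 0
    row≢0 {k} (inj₁ k≤-m) row≡0 = ℤP.<-irrefl row≡0 (proj₂ (eventually-SW origin M₀≤m k k≤-m))
    row≢0 {k} (inj₂ m≤k)  row≡0 = ℤP.<-irrefl (sym row≡0) (proj₂ (eventually-NE origin M₀≤m k m≤k))

  absurd : ⊥
  absurd = ℤP.<-irrefl refl (ℤP.<-≤-trans -1<0 (subst (+ 0 ≤_) coincidences≡-1
             (coincidences-nonneg axisSignOf axisEdgeOf (- + m) (m ℕ.+ m))))
    where
    -1<0 : -[1+ 0 ] < + 0
    -1<0 = -<+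
    coincidences≡-1 : coincidences axisSignOf axisEdgeOf (- + m) (m ℕ.+ m) ≡ -[1+ 0 ]
    coincidences≡-1 = begin
      coincidences axisSignOf axisEdgeOf (- + m) (m ℕ.+ m)
        ≡⟨ sym (ℤP.neg-involutive _) ⟩
      - - coincidences axisSignOf axisEdgeOf (- + m) (m ℕ.+ m)
        ≡⟨ cong -_ (sym (crossingNumber-change m _ boundarySweep-window axisSign-outside)) ⟩
      - (crossingNumber K NE-end - crossingNumber K SW-end)
        ≡⟨ cong₂ (λ a b → - (a - b)) crossingNumber-NE-end crossingNumber-SW-end ⟩
      -[1+ 0 ] ∎
      where
      open ≡-Reasoning

proposition2p17 : (p : Play) → Legal p → FollowsMirror p → ¬ RedWins p
proposition2p17 p legal mirror (r , (red , adj) , win) =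
  NoWinningMirroredChain.absurd r adj (λ n k → θ-of-red-is-not-red p legal mirror (red k) (red n)) win
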